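{- Consider all multiplicative functions $f:\mathbb{N}\to\mathbb{N}$ satisfying $f(p^{k-1})\le f(p^k)$ for every prime $p$ and every integer $k\ge1$, for which the set of $f$-practical numbers has an asymptotic density. The set of these asymptotic densities is dense in $[0,1]$.
   Context: $\mathbb{N}$ denotes the positive integers. $S_f(n)=\sum_{d\mid n} f(d)$. A positive integer $n$ is $f$-practical if every positive integer $m\le S_f(n)$ can be written as $m=\sum_{d\in\mathcal{D}} f(d)$ for some set $\mathcal{D}$ of divisors of $n$. -}

module Defs where

open import Data.Nat using (ℕ; zero; suc; _+_; _*_; _^_; _≤_; _<_)
open import Data.Nat.Divisibility using (_∣_; _∣?_)
open import Data.Nat.Coprimality using (Coprime)
open import Data.Nat.Primality using (Prime)
open import Data.Integer using (+_)
open import Data.Rational using (ℚ; 0ℚ; _/_; _-_; ∣_∣) renaming (_≤_ to _≤ℚ_; _<_ to _<ℚ_)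
open import Data.List using (List; filter; map; upTo)
open import Data.Nat.ListAction using (sum)
open import Data.List.Relation.Unary.All using (All)
open import Data.List.Relation.Unary.Unique.Propositional using (Unique)
open import Data.Product using (Σ; _×_; ∃)
open import Relation.Nullary using (¬_)
open import Relation.Binary.PropositionalEquality using (_≡_)

divisors : ℕ → List ℕ
divisors n = filter (_∣? n) (map suc (upTo n))

S : (ℕ → ℕ) → ℕ → ℕ
S f n = sum (map f (divisors n))

Practical : (ℕ → ℕ) → ℕ → Set
Practical f n = 1 ≤ n × (∀ m → 1 ≤ m → m ≤ S f n →
  Σ (List ℕ) λ D → All (_∣ n) D × Unique D × sum (map f D) ≡ m)

-- f : ℕ → ℕ (positive integers to positive integers) is multiplicative
-- (values on 0 are irrelevant)
Multiplicative : (ℕ → ℕ) → Set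
Multiplicative f = f 1 ≡ 1 × (∀ m n → 1 ≤ m → 1 ≤ n → Coprime m n → f (m * n) ≡ f m * f n)

PositiveValued : (ℕ → ℕ) → Set
PositiveValued f = ∀ n → 1 ≤ n → 1 ≤ f n

PrimePowerMonotone : (ℕ → ℕ) → Set
PrimePowerMonotone f = ∀ p k → Prime p → f (p ^ k) ≤ f (p ^ suc k)

-- c is the counting function of A ⊆ ℕ⁺:  c x = #{ n : 1 ≤ n ≤ x, n ∈ A }
IsCounting : (ℕ → Set) → (ℕ → ℕ) → Set
IsCounting A c = c 0 ≡ 0 ×
  (∀ x → (A (suc x) → c (suc x) ≡ suc (c x)) × (¬ A (suc x) → c (suc x) ≡ c x))

ratio : (ℕ → ℕ) → ℕ → ℚ
ratio c y = (+ c (suc y)) / suc y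

-- A has an asymptotic density δ (a real number) with a < δ < b.
-- Without reals: the sequence c(x)/x is Cauchy (so it converges to a real δ)
-- and is eventually inside [a', b'] for some rationals a < a' ≤ b' < b
-- (equivalent to δ ∈ (a,b)).
HasDensityIn : (ℕ → Set) → ℚ → ℚ → Set
HasDensityIn A a b = Σ (ℕ → ℕ) λ c → IsCounting A c ×
  ((∀ (ε : ℚ) → 0ℚ <ℚ ε → ∃ λ N → ∀ x y → N ≤ x → N ≤ y → ∣ ratio c x - ratio c y ∣ ≤ℚ ε) ×
   (Σ ℚ λ a' → Σ ℚ λ b' → a <ℚ a' × a' ≤ℚ b' × b' <ℚ b ×
      ∃ λ N → ∀ x → N ≤ x → a' ≤ℚ ratio c x × ratio c x ≤ℚ b'))

module Submission where

-- Fix a finite set P of primes and let f be completely multiplicative with f p = 1 for p ∈ P and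
-- f q = 3 for all other primes q. If some p ∈ P divides n, every divisor x with f x > 1 is y q with
-- f q = 3, and y together with its twin y / p or y p (same f-value) and a cover of y gives
-- f x ≤ 1 + Σ f over the lighter divisors; by the classical criterion every m ≤ S_f(n) is then a sum
-- of distinct divisor values. If no p ∈ P divides n > 1, all divisors except 1 have f-value ≥ 3, so 2
-- is not such a sum. Hence the f-practical numbers are 1 and the multiples of primes in P, with
-- density 1 - ∏_{p∈P} (1 - 1/p) since coprimality to P is periodic modulo ∏ P. These products are
-- dense in (0, 1]: H(Z) ∏_{p≤Z} (1 - 1/p) ≤ 1 and H(2^K) ≥ K/3 make the products over primes in
-- (y, y + k] tend to 0, and once 1/y < b - a, multiplying in the primes after y one at a time, the
-- first product below 1 - a is still above 1 - b.

open import Data.Nat using (ℕ)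
import Data.Nat as ℕ
open import Data.Nat.Primality using (Prime)
open import Data.List using (List)
open import Data.List.Relation.Unary.All using (All)
open import Data.List.Relation.Unary.Unique.Propositional using (Unique)
import Data.Rational.Unnormalised as ℚᵘ
open import Data.Product using (_×_; _,_; ∃)

module SubsetSums where

  open import Data.Nat using (ℕ; zero; suc; _+_; _∸_; _≤_; z≤n; _≤?_; _<?_)
  open import Data.Nat.Properties
  open import Data.Nat.ListAction using (sum)
  open import Data.Nat.ListAction.Properties using (sum-++)
  open import Data.List using (List; []; _∷_; map; _++_; filter; length)
  open import Data.List.Properties using (map-++; filter-++; filter-reject)
  open import Data.List.Membership.Propositional using (_∈_)
  open import Data.List.Membership.Propositional.Properties using (∈-∃++; ∈-insert)
  open import Data.List.Relation.Unary.Any using (here; there)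
  open import Data.List.Relation.Unary.All as All using (All; []; _∷_)
  open import Data.List.Relation.Unary.Unique.Propositional using (Unique)
  open import Data.List.Relation.Unary.AllPairs using ([]; _∷_)
  open import Data.Product using (Σ; _×_; _,_)
  open import Data.Sum using (_⊎_; inj₁; inj₂)
  open import Data.Empty using (⊥-elim)
  open import Relation.Nullary using (Dec; yes; no; ¬_)
  open import Relation.Unary using (Decidable)
  open import Relation.Binary.PropositionalEquality
  open import Algebra.Properties.CommutativeSemigroup +-commutativeSemigroup using (x∙yz≈y∙xz)

  total : (ℕ → ℕ) → List ℕ → ℕ
  total w L = sum (map w L)

  module _ (w : ℕ → ℕ) where

    total-++ : ∀ xs ys → total w (xs ++ ys) ≡ total w xs + total w ys
    total-++ xs ys = trans (cong sum (map-++ w xs ys)) (sum-++ (map w xs) (map w ys))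

    total-middle : ∀ xs x ys → total w (xs ++ x ∷ ys) ≡ w x + total w (xs ++ ys)
    total-middle xs x ys = begin
      total w (xs ++ x ∷ ys)           ≡⟨ total-++ xs (x ∷ ys) ⟩
      total w xs + (w x + total w ys)  ≡⟨ x∙yz≈y∙xz (total w xs) (w x) (total w ys) ⟩
      w x + (total w xs + total w ys)  ≡⟨ cong (w x +_) (total-++ xs ys) ⟨
      w x + total w (xs ++ ys)         ∎
      where open ≡-Reasoning

    total-filter≤ : ∀ {P : ℕ → Set} (P? : Decidable P) xs → total w (filter P? xs) ≤ total w xs
    total-filter≤ P? [] = z≤n
    total-filter≤ P? (x ∷ xs) with P? x
    ... | yes _ = +-monoʳ-≤ (w x) (total-filter≤ P? xs)
    ... | no _ = ≤-trans (total-filter≤ P? xs) (m≤n+m (total w xs) (w x))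

  module _ {x : ℕ} where

    All-removeMiddle : ∀ {P : ℕ → Set} xs {ys} → All P (xs ++ x ∷ ys) → P x × All P (xs ++ ys)
    All-removeMiddle [] (px ∷ pys) = px , pys
    All-removeMiddle (z ∷ xs) (pz ∷ pxs) with All-removeMiddle xs pxs
    ... | px , pxs′ = px , pz ∷ pxs′

    Unique-moveToFront : ∀ xs {ys} → Unique (xs ++ x ∷ ys) → Unique (x ∷ xs ++ ys)
    Unique-moveToFront [] u = u
    Unique-moveToFront (z ∷ xs) (z∉ ∷ u) with Unique-moveToFront xs u | All-removeMiddle xs z∉
    ... | x∉ ∷ u′ | z≢x , z∉′ = ((λ x≡z → z≢x (sym x≡z)) ∷ x∉) ∷ z∉′ ∷ u′

    ∈-removeMiddle : ∀ xs {ys z} → z ∈ xs ++ x ∷ ys → z ≢ x → z ∈ xs ++ ys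
    ∈-removeMiddle [] (here refl) z≢x = ⊥-elim (z≢x refl)
    ∈-removeMiddle [] (there z∈) _ = z∈
    ∈-removeMiddle (_ ∷ xs) (here refl) _ = here refl
    ∈-removeMiddle (_ ∷ xs) (there z∈) z≢x = there (∈-removeMiddle xs z∈ z≢x)

    ∈-insertMiddle : ∀ xs {ys z} → z ∈ xs ++ ys → z ∈ xs ++ x ∷ ys
    ∈-insertMiddle [] z∈ = there z∈
    ∈-insertMiddle (_ ∷ xs) (here refl) = here refl
    ∈-insertMiddle (_ ∷ xs) (there z∈) = there (∈-insertMiddle xs z∈)

  total-mono-⊆ : ∀ (w : ℕ → ℕ) K L → Unique K → All (_∈ L) K → total w K ≤ total w L
  total-mono-⊆ w [] L _ _ = z≤n
  total-mono-⊆ w (k ∷ K) L (k∉ ∷ uK) (k∈ ∷ K⊆L) with ∈-∃++ k∈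
  ... | xs , ys , refl = begin
    w k + total w K            ≤⟨ +-monoʳ-≤ (w k) (total-mono-⊆ w K (xs ++ ys) uK K⊆L′) ⟩
    w k + total w (xs ++ ys)   ≡⟨ total-middle w xs k ys ⟨
    total w (xs ++ k ∷ ys)     ∎
    where
    open ≤-Reasoning
    K⊆L′ : All (_∈ xs ++ ys) K
    K⊆L′ = All.zipWith (λ (z∈ , k≢z) → ∈-removeMiddle xs z∈ (λ z≡k → k≢z (sym z≡k))) (K⊆L , k∉)

  heaviest : ∀ (w : ℕ → ℕ) D → D ≡ [] ⊎ Σ ℕ λ x → x ∈ D × All (λ y → w y ≤ w x) D
  heaviest w [] = inj₁ refl
  heaviest w (d ∷ ds) with heaviest w ds
  ... | inj₁ refl = inj₂ (d , here refl , ≤-refl ∷ [])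
  ... | inj₂ (x , x∈ , ds≤x) with w x ≤? w d
  ...   | yes x≤d = inj₂ (d , here refl , ≤-refl ∷ All.map (λ y≤x → ≤-trans y≤x x≤d) ds≤x)
  ...   | no x≰d = inj₂ (x , there x∈ , ≰⇒≥ x≰d ∷ ds≤x)

  SmallGaps : (ℕ → ℕ) → List ℕ → Set
  SmallGaps w D = ∀ x → x ∈ D → w x ≤ 1 + total w (filter (λ y → w y <? w x) D)

  SubsetSum : (ℕ → ℕ) → List ℕ → ℕ → Set
  SubsetSum w D m = Σ (List ℕ) λ L → Unique L × All (_∈ D) L × total w L ≡ m

  module _ (w : ℕ → ℕ) {xs : List ℕ} {x : ℕ} {ys : List ℕ} where

    filter-removeMiddle : ∀ {P : ℕ → Set} (P? : Decidable P) → ¬ P x → filter P? (xs ++ x ∷ ys) ≡ filter P? (xs ++ ys)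
    filter-removeMiddle P? ¬Px = begin
      filter P? (xs ++ x ∷ ys)              ≡⟨ filter-++ P? xs (x ∷ ys) ⟩
      filter P? xs ++ filter P? (x ∷ ys)    ≡⟨ cong (filter P? xs ++_) (filter-reject P? ¬Px) ⟩
      filter P? xs ++ filter P? ys          ≡⟨ filter-++ P? xs ys ⟨
      filter P? (xs ++ ys)                  ∎
      where open ≡-Reasoning

    module _ (x-heaviest : All (λ y → w y ≤ w x) (xs ++ x ∷ ys)) (gaps : SmallGaps w (xs ++ x ∷ ys)) where

      smallGaps-removeHeaviest : SmallGaps w (xs ++ ys)
      smallGaps-removeHeaviest z z∈ =
        subst (λ L → w z ≤ 1 + total w L) (filter-removeMiddle (λ y → w y <? w z) (≤⇒≯ z≤x)) (gaps z (∈-insertMiddle xs z∈))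
        where z≤x = All.lookup x-heaviest (∈-insertMiddle xs z∈)

      heaviest≤1+rest : w x ≤ 1 + total w (xs ++ ys)
      heaviest≤1+rest = begin
        w x                                                 ≤⟨ gaps x (∈-insert xs) ⟩
        1 + total w (filter (λ y → w y <? w x) (xs ++ x ∷ ys)) ≡⟨ cong (λ L → 1 + total w L) (filter-removeMiddle (λ y → w y <? w x) (n≮n (w x))) ⟩
        1 + total w (filter (λ y → w y <? w x) (xs ++ ys))  ≤⟨ +-monoʳ-≤ 1 (total-filter≤ w _ (xs ++ ys)) ⟩
        1 + total w (xs ++ ys)                              ∎
        where open ≤-Reasoning

    subsetSum-insertMiddle : ∀ {m} → SubsetSum w (xs ++ ys) m → SubsetSum w (xs ++ x ∷ ys) m
    subsetSum-insertMiddle (L , uL , L⊆ , ΣL) = L , uL , All.map (∈-insertMiddle xs) L⊆ , ΣL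

    subsetSum-addMiddle : ∀ {m} → All (x ≢_) (xs ++ ys) → SubsetSum w (xs ++ ys) m → SubsetSum w (xs ++ x ∷ ys) (w x + m)
    subsetSum-addMiddle x∉ (L , uL , L⊆ , ΣL) =
      x ∷ L , All.map (λ z∈ x≡z → All.lookup x∉ z∈ x≡z) L⊆ ∷ uL , ∈-insert xs ∷ All.map (∈-insertMiddle xs) L⊆ , cong (w x +_) ΣL

  length-removeMiddle : ∀ xs {x : ℕ} ys → length (xs ++ x ∷ ys) ≡ suc (length (xs ++ ys))
  length-removeMiddle [] ys = refl
  length-removeMiddle (_ ∷ xs) ys = cong suc (length-removeMiddle xs ys)

  smallGaps⇒subsetSum : ∀ w D → Unique D → SmallGaps w D → ∀ m → m ≤ total w D → SubsetSum w D m
  smallGaps⇒subsetSum w D = go (length D) D ≤-refl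
    where
    go : ∀ k D → length D ≤ k → Unique D → SmallGaps w D → ∀ m → m ≤ total w D → SubsetSum w D m
    go k D _ _ _ m m≤ with heaviest w D
    go k .[] _ _ _ m m≤ | inj₁ refl = [] , [] , [] , sym (n≤0⇒n≡0 m≤)
    go k D len uD gaps m m≤ | inj₂ (x , x∈ , x-heaviest) with ∈-∃++ x∈
    go zero _ len _ _ m m≤ | inj₂ _ | xs , ys , refl with () ← ≤-trans (≤-reflexive (sym (length-removeMiddle xs ys))) len
    go (suc k) _ len uD gaps m m≤ | inj₂ (x , _ , x-heaviest) | xs , ys , refl with Unique-moveToFront xs uD
    ... | x∉ ∷ uD′ = split (m ≤? total w (xs ++ ys))
      where
      recurse : ∀ m → m ≤ total w (xs ++ ys) → SubsetSum w (xs ++ ys) m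
      recurse = go k (xs ++ ys) (≤-pred (≤-trans (≤-reflexive (sym (length-removeMiddle xs ys))) len)) uD′ (smallGaps-removeHeaviest w x-heaviest gaps)

      split : Dec (m ≤ total w (xs ++ ys)) → SubsetSum w (xs ++ x ∷ ys) m
      split (yes m≤rest) = subsetSum-insertMiddle w (recurse m m≤rest)
      split (no m≰rest) = subst (SubsetSum w (xs ++ x ∷ ys)) (m+[n∸m]≡n wx≤m) (subsetSum-addMiddle w x∉ (recurse (m ∸ w x) m∸wx≤rest))
        where
        wx≤m : w x ≤ m
        wx≤m = ≤-trans (heaviest≤1+rest w x-heaviest gaps) (≰⇒> m≰rest)
        m∸wx≤rest : m ∸ w x ≤ total w (xs ++ ys)
        m∸wx≤rest = begin
          m ∸ w x                          ≤⟨ ∸-monoˡ-≤ (w x) m≤ ⟩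
          total w (xs ++ x ∷ ys) ∸ w x     ≡⟨ cong (_∸ w x) (total-middle w xs x ys) ⟩
          w x + total w (xs ++ ys) ∸ w x   ≡⟨ m+n∸m≡n (w x) _ ⟩
          total w (xs ++ ys)               ∎
          where open ≤-Reasoning

module Factorisations where

  open import Data.Nat using (zero; suc; _*_; _≤_; z≤n; s≤s)
  open import Data.Nat.Properties using (*-mono-≤; *-comm; >⇒≢)
  open import Data.Nat.Divisibility using (_∣_; divides)
  open import Data.Nat.Primality using (¬prime[0]; ¬prime[1])
  open import Data.Nat.Primality.Factorisation using (PrimeFactorisation; factorise)
  open import Data.Nat.ListAction using (product)
  open import Data.Nat.ListAction.Properties using (product-++)
  open import Data.List using ([]; _∷_; _++_)
  open import Data.List.Relation.Unary.All using (All; []; _∷_)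
  open import Data.List.Relation.Unary.All.Properties using (++⁺)
  open import Relation.Nullary using (contradiction)
  open import Relation.Binary.PropositionalEquality using (_≡_; trans; sym; cong₂)

  prime≥2 : ∀ {p} → Prime p → 2 ≤ p
  prime≥2 {zero} p-prime = contradiction p-prime ¬prime[0]
  prime≥2 {suc zero} p-prime = contradiction p-prime ¬prime[1]
  prime≥2 {suc (suc _)} _ = s≤s (s≤s z≤n)

  primeFactor : ∀ {n} → 2 ≤ n → ∃ λ q → Prime q × q ∣ n
  primeFactor {n@(suc _)} 2≤n = firstFactor (factors fn) (isFactorisation fn) (factorsPrime fn)
    where
    open PrimeFactorisation
    fn = factorise n
    firstFactor : ∀ qs → n ≡ product qs → All Prime qs → ∃ λ q → Prime q × q ∣ n
    firstFactor [] n≡1 _ = contradiction n≡1 (>⇒≢ 2≤n)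
    firstFactor (q ∷ qs) n≡ (q-prime ∷ _) = q , q-prime , divides (product qs) (trans n≡ (*-comm q (product qs)))

  product≥1 : ∀ {ns} → All (1 ≤_) ns → 1 ≤ product ns
  product≥1 [] = s≤s z≤n
  product≥1 (n≥1 ∷ ns≥1) = *-mono-≤ n≥1 (product≥1 ns≥1)

  factorisation-* : ∀ {m n} → PrimeFactorisation m → PrimeFactorisation n → PrimeFactorisation (m * n)
  factorisation-* fm fn = record
    { factors = factors fm ++ factors fn
    ; isFactorisation = trans (cong₂ _*_ (isFactorisation fm) (isFactorisation fn)) (sym (product-++ (factors fm) (factors fn)))
    ; factorsPrime = ++⁺ (factorsPrime fm) (factorsPrime fn)
    }
    where open PrimeFactorisation

module Construction (ps : List ℕ) where

  open import Data.Nat using (zero; suc; _*_; _≤_; z≤n; s≤s; NonZero; _≟_)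
  open import Data.Nat.Properties using (*-identityʳ)
  open import Data.Nat.Primality using (Prime)
  open import Data.Nat.Primality.Factorisation
  open import Data.Nat.ListAction using (product)
  open import Data.Nat.ListAction.Properties using (product-++; product-↭)
  open import Data.List using (map; _++_)
  open import Data.List.Properties using (map-++)
  open import Data.List.Membership.DecPropositional _≟_ using (_∈_; _∉_; _∈?_)
  open import Data.List.Relation.Binary.Permutation.Propositional.Properties using (map⁺)
  import Data.List.Relation.Unary.All as All
  import Data.List.Relation.Unary.All.Properties as AllP
  open import Relation.Nullary using (yes; no; contradiction)
  open import Relation.Binary.PropositionalEquality
  open Factorisations

  onPrimes : ℕ → ℕ
  onPrimes q with q ∈? ps
  ... | yes _ = 1
  ... | no _ = 3

  onPrimes-∈ : ∀ {q} → q ∈ ps → onPrimes q ≡ 1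
  onPrimes-∈ {q} q∈ with q ∈? ps
  ... | yes _ = refl
  ... | no q∉ = contradiction q∈ q∉

  onPrimes-∉ : ∀ {q} → q ∉ ps → onPrimes q ≡ 3
  onPrimes-∉ {q} q∉ with q ∈? ps
  ... | yes q∈ = contradiction q∈ q∉
  ... | no _ = refl

  onPrimes≥1 : ∀ q → 1 ≤ onPrimes q
  onPrimes≥1 q with q ∈? ps
  ... | yes _ = s≤s z≤n
  ... | no _ = s≤s z≤n

  f : ℕ → ℕ
  f zero = 1
  f n@(suc _) = product (map onPrimes (factors (factorise n)))

  f-factorisation : ∀ {n} .{{_ : NonZero n}} (fn : PrimeFactorisation n) → f n ≡ product (map onPrimes (factors fn))
  f-factorisation {suc n} fn = product-↭ (map⁺ onPrimes (factorisationUnique (factorise (suc n)) fn))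

  f-* : ∀ {m n} → 1 ≤ m → 1 ≤ n → f (m * n) ≡ f m * f n
  f-* {suc m} {suc n} _ _ = begin
    f (suc m * suc n)                          ≡⟨ f-factorisation (factorisation-* fm fn) ⟩
    product (map onPrimes (xs ++ ys))          ≡⟨ cong product (map-++ onPrimes xs ys) ⟩
    product (map onPrimes xs ++ map onPrimes ys) ≡⟨ product-++ (map onPrimes xs) (map onPrimes ys) ⟩
    f (suc m) * f (suc n)                      ∎
    where
    open ≡-Reasoning
    fm = factorise (suc m)
    fn = factorise (suc n)
    xs = factors fm
    ys = factors fn

  f-prime : ∀ {p} → Prime p → f p ≡ onPrimes p
  f-prime {suc p} p-prime = trans (f-factorisation (primeFactorisation[p] p-prime)) (*-identityʳ (onPrimes (suc p)))

  f≥1 : ∀ n → 1 ≤ f n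
  f≥1 zero = s≤s z≤n
  f≥1 n@(suc _) = product≥1 (AllP.map⁺ (All.universal onPrimes≥1 (factors (factorise n))))

module DivisorList where

  open import Data.Nat using (zero; suc; _≤_; z≤n; s≤s)
  open import Data.Nat.Properties using (suc-injective)
  open import Data.Nat.Divisibility using (_∣_; _∣?_; 0∣⇒≡0; ∣⇒≤)
  open import Data.List using (map; upTo)
  open import Data.List.Membership.Propositional using (_∈_)
  open import Data.List.Membership.Propositional.Properties using (∈-filter⁺; ∈-filter⁻; ∈-map⁺; ∈-upTo⁺)
  open import Data.List.Relation.Unary.Unique.Propositional using (Unique)
  open import Data.List.Relation.Unary.Unique.Propositional.Properties using (filter⁺; map⁺; upTo⁺)
  open import Data.Product using (proj₂)
  open import Relation.Nullary using (contradiction)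
  open import Defs using (divisors)

  divisor≥1 : ∀ {n d} → 1 ≤ n → d ∣ n → 1 ≤ d
  divisor≥1 {suc n} {zero} _ 0∣n = contradiction (0∣⇒≡0 0∣n) λ ()
  divisor≥1 {_} {suc d} _ _ = s≤s z≤n

  ∈-divisors⁻ : ∀ {n d} → d ∈ divisors n → d ∣ n
  ∈-divisors⁻ {n} d∈ = proj₂ (∈-filter⁻ (_∣? n) {xs = map suc (upTo n)} d∈)

  ∈-divisors⁺ : ∀ {n d} → 1 ≤ n → d ∣ n → d ∈ divisors n
  ∈-divisors⁺ {suc n} {zero} _ 0∣n = contradiction (0∣⇒≡0 0∣n) λ ()
  ∈-divisors⁺ {suc n} {suc d} _ d∣n = ∈-filter⁺ (_∣? suc n) (∈-map⁺ suc (∈-upTo⁺ (∣⇒≤ d∣n))) d∣n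

  divisors-unique : ∀ n → Unique (divisors n)
  divisors-unique n = filter⁺ (_∣? n) (map⁺ suc-injective (upTo⁺ n))

module OneOrMultiple where

  open import Data.Nat using (_≟_)
  open import Data.Nat.Divisibility using (_∣_; _∣?_)
  open import Data.List.Relation.Unary.Any using (Any; any?)
  open import Data.Sum using (_⊎_)
  open import Relation.Nullary.Decidable using (_⊎-dec_)
  open import Relation.Unary using (Decidable)
  open import Relation.Binary.PropositionalEquality using (_≡_)

  OneOrMultipleOf : List ℕ → ℕ → Set
  OneOrMultipleOf ps n = n ≡ 1 ⊎ Any (_∣ n) ps

  oneOrMultipleOf? : ∀ ps → Decidable (OneOrMultipleOf ps)
  oneOrMultipleOf? ps n = (n ≟ 1) ⊎-dec any? (_∣? n) ps


module PracticalNumbers (ps : List ℕ) (ps-prime : All Prime ps) where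

  open import Data.Nat using (ℕ; zero; suc; _+_; _*_; _≤_; _<_; z≤n; s≤s; _<?_; _≟_; NonZero; >-nonZero)
  open import Data.Nat.Properties
  open import Data.Nat.Divisibility using (_∣_; _∣?_; divides; ∣-trans; ∣1⇒≡1; ∣-refl; 1∣_)
  open import Data.Nat.Primality using (Prime; euclidsLemma)
  open import Data.Nat.Primality.Factorisation using (PrimeFactorisation; factorise; factors)
  open import Data.Nat.ListAction using (sum; product)
  open import Data.Nat.ListAction.Properties using (∈⇒∣product)
  open import Data.Nat.Induction using (<-rec)
  open import Data.List using (List; []; _∷_; map; filter)
  open import Data.List.Membership.Propositional using (_∈_; _∉_; find)
  open import Data.List.Membership.Propositional.Properties using (∈-filter⁺)
  open import Data.List.Membership.DecPropositional _≟_ using (_∈?_)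
  open import Data.List.Relation.Unary.Any as Any using (Any; any?)
  open import Data.List.Relation.Unary.All as All using (All; []; _∷_; all?)
  open import Data.List.Relation.Unary.All.Properties as AllP using (¬All⇒Any¬)
  open import Data.List.Relation.Unary.Unique.Propositional using (Unique)
  open import Data.List.Relation.Unary.AllPairs using ([]; _∷_)
  open import Data.Product using (Σ; ∃; _×_; _,_)
  open import Data.Sum using (inj₁; inj₂)
  open import Relation.Nullary using (yes; no; ¬_; contradiction)
  open import Relation.Binary.PropositionalEquality
  open import Defs using (divisors; S; Practical)
  open SubsetSums
  open Factorisations using (prime≥2; primeFactor)
  open Construction ps
  open DivisorList
  open OneOrMultiple

  3≰2 : ¬ 3 ≤ 2
  3≰2 (s≤s (s≤s ()))

  f-∈ : ∀ {p} → p ∈ ps → f p ≡ 1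
  f-∈ p∈ = trans (f-prime (All.lookup ps-prime p∈)) (onPrimes-∈ p∈)

  f-∉ : ∀ {q} → Prime q → q ∉ ps → f q ≡ 3
  f-∉ q-prime q∉ = trans (f-prime q-prime) (onPrimes-∉ q∉)

  f-*∈ : ∀ {z p} → p ∈ ps → 1 ≤ z → f (z * p) ≡ f z
  f-*∈ {z} {p} p∈ 1≤z = begin
    f (z * p)   ≡⟨ f-* 1≤z (≤-trans (s≤s z≤n) (prime≥2 (All.lookup ps-prime p∈))) ⟩
    f z * f p   ≡⟨ cong (f z *_) (f-∈ p∈) ⟩
    f z * 1     ≡⟨ *-identityʳ (f z) ⟩
    f z         ∎
    where open ≡-Reasoning

  factor-∣ : ∀ {x q} .{{_ : NonZero x}} → q ∈ factors (factorise x) → q ∣ x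
  factor-∣ {x} q∈ = subst (_ ∣_) (sym (PrimeFactorisation.isFactorisation (factorise x))) (∈⇒∣product q∈)

  product-onPrimes-∈ : ∀ {qs} → All (_∈ ps) qs → product (map onPrimes qs) ≡ 1
  product-onPrimes-∈ [] = refl
  product-onPrimes-∈ {q ∷ _} (q∈ ∷ qs∈) = cong₂ _*_ (onPrimes-∈ q∈) (product-onPrimes-∈ qs∈)

  outsideFactor : ∀ x → 1 < f x → ∃ λ q → Prime q × q ∣ x × q ∉ ps
  outsideFactor zero (s≤s ())
  outsideFactor x@(suc _) 1<fx with all? (_∈? ps) (factors (factorise x))
  ... | yes all∈ = contradiction (product-onPrimes-∈ all∈) (>⇒≢ 1<fx)
  ... | no ¬all∈ with find (¬All⇒Any¬ (_∈? ps) _ ¬all∈)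
  ...   | q , q∈ , q∉ = q , All.lookup (PrimeFactorisation.factorsPrime (factorise x)) q∈ , factor-∣ q∈ , q∉

  f≥3 : ∀ {n d} → 2 ≤ d → d ∣ n → ¬ Any (_∣ n) ps → 3 ≤ f d
  f≥3 {n} {d} 2≤d d∣n ps∤n with primeFactor 2≤d
  ... | q , q-prime , divides e d≡eq = begin
    3             ≡⟨ f-∉ q-prime q∉ps ⟨
    f q           ≤⟨ m≤n*m (f q) (f e) {{>-nonZero (f≥1 e)}} ⟩
    f e * f q     ≡⟨ f-* 1≤e (≤-trans (s≤s z≤n) (prime≥2 q-prime)) ⟨
    f (e * q)     ≡⟨ cong f d≡eq ⟨
    f d           ∎
    where
    open ≤-Reasoning
    1≤e = divisor≥1 (≤-trans (s≤s z≤n) 2≤d) (divides q (trans d≡eq (*-comm e q)))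
    q∉ps : q ∉ ps
    q∉ps q∈ps = ps∤n (Any.map (λ { refl → ∣-trans (divides e d≡eq) d∣n }) q∈ps)

  triple≤ : ∀ a s → a ≤ 1 + s → 3 * a ≤ 1 + (a + (a + s))
  triple≤ a s a≤1+s = begin
    3 * a              ≡⟨ cong (λ t → a + (a + t)) (+-identityʳ a) ⟩
    a + (a + a)        ≤⟨ +-monoʳ-≤ a (+-monoʳ-≤ a a≤1+s) ⟩
    a + (a + (1 + s))  ≡⟨ cong (a +_) (+-suc a s) ⟩
    a + suc (a + s)    ≡⟨ +-suc a (a + s) ⟩
    1 + (a + (a + s))  ∎
    where open ≤-Reasoning

  module _ {n p} (1≤n : 1 ≤ n) (p∈ : p ∈ ps) (p∣n : p ∣ n) where

    private
      p-prime = All.lookup ps-prime p∈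
      2≤p = prime≥2 p-prime

    twin : ∀ {y} → 1 ≤ y → y ∣ n → ∃ λ y′ → y′ ∣ n × f y′ ≡ f y × y′ ≢ y
    twin {y} 1≤y y∣n with p ∣? y
    ... | yes (divides z y≡zp) = z , ∣-trans (divides p (trans y≡zp (*-comm z p))) y∣n , f-z , z≢y
      where
      1≤z = divisor≥1 1≤y (divides p (trans y≡zp (*-comm z p)))
      f-z : f z ≡ f y
      f-z = sym (trans (cong f y≡zp) (f-*∈ p∈ 1≤z))
      z≢y : z ≢ y
      z≢y z≡y = <-irrefl (trans z≡y y≡zp) (m<m*n z p {{>-nonZero 1≤z}} 2≤p)
    ... | no p∤y with y∣n
    ...   | divides t n≡ty with euclidsLemma t y p-prime (subst (p ∣_) n≡ty p∣n)
    ...     | inj₂ p∣y = contradiction p∣y p∤y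
    ...     | inj₁ (divides s t≡sp) = y * p , divides s n≡s[yp] , f-*∈ p∈ 1≤y , yp≢y
      where
      n≡s[yp] : n ≡ s * (y * p)
      n≡s[yp] = trans n≡ty (trans (cong (_* y) t≡sp) (trans (*-assoc s p y) (cong (s *_) (*-comm p y))))
      yp≢y : y * p ≢ y
      yp≢y yp≡y = <-irrefl (sym yp≡y) (m<m*n y p {{>-nonZero 1≤y}} 2≤p)

    LighterCover : ℕ → Set
    LighterCover x = Σ (List ℕ) λ L → Unique L × All (_∣ n) L × All (λ y → f y < f x) L × f x ≤ 1 + total f L

    lighterCover : ∀ x → x ∣ n → LighterCover x
    lighterCover = <-rec (λ x → x ∣ n → LighterCover x) cover
      where
      cover : ∀ x → (∀ {y} → y < x → y ∣ n → LighterCover y) → x ∣ n → LighterCover x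
      cover x rec x∣n with 1 <? f x
      ... | no fx≯1 = [] , [] , [] , [] , ≤-trans (≮⇒≥ fx≯1) (m≤m+n 1 0)
      ... | yes 1<fx with outsideFactor x 1<fx
      ...   | q , q-prime , divides y x≡yq , q∉ = extend (twin 1≤y y∣n) (rec y<x y∣n)
        where
        y∣x = divides q (trans x≡yq (*-comm y q))
        1≤y = divisor≥1 (divisor≥1 1≤n x∣n) y∣x
        y∣n = ∣-trans y∣x x∣n
        y<x = subst (y <_) (sym x≡yq) (m<m*n y q {{>-nonZero 1≤y}} (prime≥2 q-prime))
        fx≡3fy : f x ≡ 3 * f y
        fx≡3fy = trans (cong f x≡yq) (trans (f-* 1≤y (≤-trans (s≤s z≤n) (prime≥2 q-prime))) (trans (cong (f y *_) (f-∉ q-prime q∉)) (*-comm (f y) 3)))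
        fy<fx : f y < f x
        fy<fx = subst (f y <_) (sym fx≡3fy) (subst (_< 3 * f y) (*-identityˡ (f y)) (*-monoˡ-< (f y) {{>-nonZero (f≥1 y)}} {1} {3} (s≤s (s≤s z≤n))))
        extend : (∃ λ y′ → y′ ∣ n × f y′ ≡ f y × y′ ≢ y) → LighterCover y → LighterCover x
        extend (y′ , y′∣n , fy′≡fy , y′≢y) (R , uR , R∣n , R<y , fy≤) =
          y ∷ y′ ∷ R , uniq , y∣n ∷ y′∣n ∷ R∣n , fy<fx ∷ subst (_< f x) (sym fy′≡fy) fy<fx ∷ All.map (λ r<y → <-trans r<y fy<fx) R<y , bound
          where
          uniq : Unique (y ∷ y′ ∷ R)
          uniq = ((λ y≡y′ → y′≢y (sym y≡y′)) ∷ All.map (λ r<y y≡r → <-irrefl (cong f (sym y≡r)) r<y) R<y)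
               ∷ All.map (λ r<y y′≡r → <-irrefl (trans (cong f (sym y′≡r)) fy′≡fy) r<y) R<y ∷ uR
          bound : f x ≤ 1 + total f (y ∷ y′ ∷ R)
          bound = subst₂ (λ a b → a ≤ 1 + (f y + (b + total f R))) (sym fx≡3fy) (sym fy′≡fy) (triple≤ (f y) (total f R) fy≤)

    smallGaps-multiple : SmallGaps f (divisors n)
    smallGaps-multiple x x∈ with lighterCover x (∈-divisors⁻ x∈)
    ... | L , uL , L∣n , L<x , fx≤ = ≤-trans fx≤ (+-monoʳ-≤ 1 (total-mono-⊆ f L _ uL L⊆))
      where
      L⊆ : All (_∈ filter (λ y → f y <? f x) (divisors n)) L
      L⊆ = All.zipWith (λ (d∣n , fd<fx) → ∈-filter⁺ (λ y → f y <? f x) (∈-divisors⁺ 1≤n d∣n) fd<fx) (L∣n , L<x)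

  smallGaps-one : SmallGaps f (divisors 1)
  smallGaps-one x x∈ = subst (λ d → f d ≤ 1 + total f (filter (λ y → f y <? f x) (divisors 1))) (sym (∣1⇒≡1 (∈-divisors⁻ x∈))) (m≤m+n 1 _)

  smallGaps : ∀ {n} → 1 ≤ n → OneOrMultipleOf ps n → SmallGaps f (divisors n)
  smallGaps _ (inj₁ refl) = smallGaps-one
  smallGaps 1≤n (inj₂ p∣n) with find p∣n
  ... | p , p∈ , p∣n′ = smallGaps-multiple 1≤n p∈ p∣n′

  practical⁺ : ∀ {n} → 1 ≤ n → OneOrMultipleOf ps n → Practical f n
  practical⁺ {n} 1≤n one-or-multiple = 1≤n , λ m _ m≤ → represent (smallGaps⇒subsetSum f (divisors n) (divisors-unique n) (smallGaps 1≤n one-or-multiple) m m≤)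
    where
    represent : ∀ {m} → SubsetSum f (divisors n) m → Σ (List ℕ) λ D → All (_∣ n) D × Unique D × sum (map f D) ≡ m
    represent (L , uL , L⊆ , ΣL) = L , All.map ∈-divisors⁻ L⊆ , uL , ΣL

  no-subsetSum-2 : ∀ {n} → 1 ≤ n → ¬ Any (_∣ n) ps → ∀ D → Unique D → All (_∣ n) D → total f D ≢ 2
  no-subsetSum-2 _ _ [] _ _ ()
  no-subsetSum-2 1≤n ps∤n (d ∷ D) (d∉ ∷ _) (d∣n ∷ D∣n) ΣD≡2 with d ≟ 1
  ... | no d≢1 = 3≰2 (begin
    3                   ≤⟨ f≥3 (≤∧≢⇒< (divisor≥1 1≤n d∣n) (≢-sym d≢1)) d∣n ps∤n ⟩
    f d                 ≤⟨ m≤m+n (f d) _ ⟩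
    total f (d ∷ D)     ≡⟨ ΣD≡2 ⟩
    2                   ∎)
    where open ≤-Reasoning
  no-subsetSum-2 1≤n ps∤n (.1 ∷ []) _ _ () | yes refl
  no-subsetSum-2 1≤n ps∤n (.1 ∷ e ∷ D) ((1≢e ∷ _) ∷ _) (_ ∷ e∣n ∷ _) ΣD≡2 | yes refl = 3≰2 (begin
    3                   ≤⟨ f≥3 (≤∧≢⇒< (divisor≥1 1≤n e∣n) 1≢e) e∣n ps∤n ⟩
    f e                 ≤⟨ m≤m+n (f e) _ ⟩
    total f (e ∷ D)     ≤⟨ m≤n+m _ 1 ⟩
    total f (1 ∷ e ∷ D) ≡⟨ ΣD≡2 ⟩
    2                   ∎)
    where open ≤-Reasoning

  practical⁻ : ∀ {n} → Practical f n → OneOrMultipleOf ps n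
  practical⁻ {n} (1≤n , practical) with n ≟ 1 | any? (_∣? n) ps
  ... | yes n≡1 | _ = inj₁ n≡1
  ... | no _ | yes p∣n = inj₂ p∣n
  ... | no n≢1 | no ps∤n with practical 2 (s≤s z≤n) 2≤S
    where
    2≤S : 2 ≤ S f n
    2≤S = begin
      2                        ≤⟨ s≤s (≤-trans (s≤s z≤n) (≤-trans (f≥3 (≤∧≢⇒< 1≤n (≢-sym n≢1)) ∣-refl ps∤n) (m≤m+n (f n) 0))) ⟩
      total f (1 ∷ n ∷ [])     ≤⟨ total-mono-⊆ f (1 ∷ n ∷ []) (divisors n) ((≢-sym n≢1 ∷ []) ∷ [] ∷ []) (∈-divisors⁺ 1≤n (1∣ n) ∷ ∈-divisors⁺ 1≤n ∣-refl ∷ []) ⟩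
      S f n                    ∎
      where open ≤-Reasoning
  ... | D , D∣n , uD , ΣD≡2 = contradiction ΣD≡2 (no-subsetSum-2 1≤n ps∤n D uD D∣n)

module Counting where

  open import Data.Nat using (zero; suc; _+_; _*_; _≤_; z≤n; s≤s; >-nonZero)
  open import Data.Nat.Properties
  open import Data.Nat.Divisibility using (_∣_; _∣?_; ∣⇒≤; ∣m+n∣m⇒∣n; ∣m∣n⇒∣m+n; ∣-refl; n∣m*n)
  open import Data.Product using (_×_; _,_; proj₂)
  open import Function using (id; _⇔_; mk⇔; Equivalence)
  open import Relation.Nullary using (Dec; yes; no; ¬_; contradiction)
  open import Relation.Nullary.Decidable using (_×-dec_; ¬?)
  open import Relation.Unary using (Decidable)
  open import Relation.Binary.PropositionalEquality

  indicator : ∀ {A : Set} → Dec A → ℕ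
  indicator (yes _) = 1
  indicator (no _) = 0

  indicator-cong : ∀ {A B : Set} (a? : Dec A) (b? : Dec B) → A ⇔ B → indicator a? ≡ indicator b?
  indicator-cong (yes _) (yes _) _ = refl
  indicator-cong (yes a) (no ¬b) a⇔b = contradiction (Equivalence.to a⇔b a) ¬b
  indicator-cong (no ¬a) (yes b) a⇔b = contradiction (Equivalence.from a⇔b b) ¬a
  indicator-cong (no _) (no _) _ = refl

  indicator≤1 : ∀ {A : Set} (a? : Dec A) → indicator a? ≤ 1
  indicator≤1 (yes _) = s≤s z≤n
  indicator≤1 (no _) = z≤n

  count : ∀ {P : ℕ → Set} → Decidable P → ℕ → ℕ
  count P? zero = zero
  count P? (suc x) = indicator (P? (suc x)) + count P? x

  count-cong : ∀ {P Q : ℕ → Set} (P? : Decidable P) (Q? : Decidable Q) x →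
    (∀ n → 1 ≤ n → n ≤ x → P n ⇔ Q n) → count P? x ≡ count Q? x
  count-cong P? Q? zero _ = refl
  count-cong P? Q? (suc x) P⇔Q = cong₂ _+_ (indicator-cong (P? (suc x)) (Q? (suc x)) (P⇔Q (suc x) (s≤s z≤n) ≤-refl))
    (count-cong P? Q? x λ n 1≤n n≤x → P⇔Q n 1≤n (m≤n⇒m≤1+n n≤x))

  count-none : ∀ {P : ℕ → Set} (P? : Decidable P) x → (∀ n → 1 ≤ n → n ≤ x → ¬ P n) → count P? x ≡ 0
  count-none P? zero _ = refl
  count-none P? (suc x) ¬P with P? (suc x)
  ... | yes Px = contradiction Px (¬P (suc x) (s≤s z≤n) ≤-refl)
  ... | no _ = count-none P? x λ n 1≤n n≤x → ¬P n 1≤n (m≤n⇒m≤1+n n≤x)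

  count-+ : ∀ {P : ℕ → Set} (P? : Decidable P) b a → count P? (b + a) ≡ count (λ n → P? (n + a)) b + count P? a
  count-+ P? zero a = refl
  count-+ P? (suc b) a = trans (cong (indicator (P? (suc (b + a))) +_) (count-+ P? b a)) (sym (+-assoc (indicator (P? (suc (b + a)))) _ _))

  module _ {P : ℕ → Set} (P? : Decidable P) where

    count≤ : ∀ x → count P? x ≤ x
    count≤ zero = z≤n
    count≤ (suc x) = +-mono-≤ (indicator≤1 (P? (suc x))) (count≤ x)

    count-partition : ∀ {Q : ℕ → Set} (Q? : Decidable Q) x →
      count P? x ≡ count (λ n → P? n ×-dec Q? n) x + count (λ n → P? n ×-dec ¬? (Q? n)) x
    count-partition Q? zero = refl
    count-partition Q? (suc x) with P? (suc x) | Q? (suc x)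
    ... | yes _ | yes _ = cong suc (count-partition Q? x)
    ... | yes _ | no _ = trans (cong suc (count-partition Q? x)) (sym (+-suc _ _))
    ... | no _ | yes _ = count-partition Q? x
    ... | no _ | no _ = count-partition Q? x

    module _ (M : ℕ) (periodic : ∀ n → P (n + M) ⇔ P n) where

      periodic-* : ∀ q n → P (n + q * M) ⇔ P n
      periodic-* zero n = subst (λ m → P m ⇔ P n) (sym (+-identityʳ n)) (mk⇔ id id)
      periodic-* (suc q) n = mk⇔ (λ x → to (periodic n) (to (periodic-* q (n + M)) (subst P (sym (+-assoc n M (q * M))) x)))
                                  (λ x → subst P (+-assoc n M (q * M)) (from (periodic-* q (n + M)) (from (periodic n) x)))
        where open Equivalence

      count-periodic : ∀ q r → count P? (r + q * M) ≡ count P? r + q * count P? M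
      count-periodic q r = trans (count-+ P? r (q * M)) (cong₂ _+_ (shift q r) (count-period q))
        where
        shift : ∀ q b → count (λ n → P? (n + q * M)) b ≡ count P? b
        shift q b = count-cong (λ n → P? (n + q * M)) P? b (λ n _ _ → periodic-* q n)
        count-period : ∀ q → count P? (q * M) ≡ q * count P? M
        count-period zero = refl
        count-period (suc q) = trans (count-+ P? M (q * M)) (cong₂ _+_ (shift q M) (count-period q))

    count-multiples : ∀ p′ y → count (λ n → (suc p′ ∣? n) ×-dec P? n) (y * suc p′) ≡ count (λ m → P? (m * suc p′)) y
    count-multiples p′ zero = refl
    count-multiples p′ (suc y) = trans (count-+ (λ n → (p ∣? n) ×-dec P? n) p (y * p)) (cong₂ _+_ block (count-multiples p′ y))
      where
      p = suc p′
      Q? : Decidable (λ n → p ∣ n + y * p × P (n + y * p))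
      Q? n = (p ∣? n + y * p) ×-dec P? (n + y * p)
      block : count Q? p ≡ indicator (P? (p + y * p))
      block = begin
        indicator (Q? p) + count Q? p′   ≡⟨ cong₂ _+_ (indicator-cong (Q? p) (P? (p + y * p)) (mk⇔ proj₂ (∣m∣n⇒∣m+n ∣-refl (n∣m*n y) ,_))) (count-none Q? p′ nonMultiples) ⟩
        indicator (P? (p + y * p)) + 0   ≡⟨ +-identityʳ _ ⟩
        indicator (P? (p + y * p))       ∎
        where
        open ≡-Reasoning
        nonMultiples : ∀ n → 1 ≤ n → n ≤ p′ → ¬ (p ∣ n + y * p × P (n + y * p))
        nonMultiples n 1≤n n≤p′ (p∣ , _) = <⇒≱ (s≤s n≤p′) (∣⇒≤ {{>-nonZero 1≤n}} (∣m+n∣m⇒∣n (subst (p ∣_) (+-comm n (y * p)) p∣) (n∣m*n y)))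

module CoprimeResidues where

  open import Data.Nat using (zero; suc; pred; _+_; _*_; _≤_; z≤n; s≤s; NonZero; >-nonZero)
  open import Data.Nat.Properties
  open import Data.Nat.DivMod using (_%_; _/_; m≡m%n+[m/n]*n; m%n<n)
  open import Data.Nat.Divisibility using (_∣_; _∣?_; ∣m+n∣m⇒∣n; ∣m∣n⇒∣m+n; ∣m⇒∣m*n; ∣1⇒≡1)
  open import Data.Nat.Primality using (Prime; euclidsLemma; prime⇒irreducible; productOfPrimes≥1; ¬prime[0]; ¬prime[1])
  open import Data.Nat.ListAction using (product)
  open import Data.Nat.ListAction.Properties using (∈⇒∣product)
  open import Data.Nat.Tactic.RingSolver using (solve-∀)
  open import Data.List using (List; []; _∷_; map)
  open import Data.List.Membership.Propositional using (_∈_; _∉_)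
  open import Data.List.Relation.Unary.All as All using (All; []; _∷_; all?)
  open import Data.List.Relation.Unary.All.Properties using (¬Any⇒All¬; All¬⇒¬Any)
  open import Data.List.Relation.Unary.Unique.Propositional using (Unique)
  open import Data.List.Relation.Unary.AllPairs using ([]; _∷_)
  open import Data.Product using (_,_; swap)
  open import Data.Sum using (inj₁; inj₂; [_,_]′)
  open import Function using (_∘_; _⇔_; mk⇔)
  open import Relation.Nullary using (yes; no; ¬_; contradiction)
  open import Algebra.Properties.CommutativeSemigroup +-commutativeSemigroup using (x∙yz≈y∙xz)
  open import Relation.Nullary.Decidable using (_×-dec_; ¬?)
  open import Relation.Unary using (Decidable)
  open import Relation.Binary.PropositionalEquality
  open Counting
  open OneOrMultiple

  CoprimeTo : List ℕ → ℕ → Set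
  CoprimeTo ps n = All (λ p → ¬ p ∣ n) ps

  coprimeTo? : ∀ ps → Decidable (CoprimeTo ps)
  coprimeTo? ps n = all? (λ p → ¬? (p ∣? n)) ps

  φ : List ℕ → ℕ
  φ ps = product (map pred ps)

  φ≤product : ∀ ps → φ ps ≤ product ps
  φ≤product [] = ≤-refl
  φ≤product (p ∷ ps) = *-mono-≤ (pred[n]≤n {p}) (φ≤product ps)

  coprimeTo-periodic : ∀ ps n → CoprimeTo ps (n + product ps) ⇔ CoprimeTo ps n
  coprimeTo-periodic ps n = mk⇔
    (λ c → All.zipWith (λ (p∤n+M , p∣M) p∣n → p∤n+M (∣m∣n⇒∣m+n p∣n p∣M)) (c , ps∣M))
    (λ c → All.zipWith (λ {p} (p∤n , p∣M) p∣n+M → p∤n (∣m+n∣m⇒∣n (subst (p ∣_) (+-comm n (product ps)) p∣n+M) p∣M)) (c , ps∣M))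
    where
    ps∣M : All (_∣ product ps) ps
    ps∣M = All.tabulate ∈⇒∣product

  coprimeTo-*prime : ∀ {p} ps → All Prime ps → Prime p → p ∉ ps → ∀ m → CoprimeTo ps (m * p) ⇔ CoprimeTo ps m
  coprimeTo-*prime {p} ps ps-prime p-prime p∉ m = mk⇔
    (All.map (λ q∤mp q∣m → q∤mp (∣m⇒∣m*n p q∣m)))
    (λ c → All.tabulate λ q∈ q∣mp → [ All.lookup c q∈ , (λ q∣p → p∉ (subst (_∈ ps) (prime∣prime (All.lookup ps-prime q∈) q∣p) q∈)) ]′ (euclidsLemma m p (All.lookup ps-prime q∈) q∣mp))
    where
    prime∣prime : ∀ {q} → Prime q → q ∣ p → q ≡ p
    prime∣prime q-prime q∣p with prime⇒irreducible p-prime q∣p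
    ... | inj₁ refl = contradiction q-prime ¬prime[1]
    ... | inj₂ q≡p = q≡p

  -- Among 1, …, p M the numbers coprime to ps are the (p - 1) M residues coprime to p ∷ ps,
  -- together with the M multiples of p that are coprime to ps.
  count-coprimeTo-product : ∀ ps → All Prime ps → Unique ps → count (coprimeTo? ps) (product ps) ≡ φ ps
  count-coprimeTo-product [] [] [] = refl
  count-coprimeTo-product (p@(suc p′) ∷ ps) (p-prime ∷ ps-prime) (p∉′ ∷ ps-unique) = begin
    count (coprimeTo? (p ∷ ps)) (p * M)   ≡⟨ count-cong (coprimeTo? (p ∷ ps)) coprime∧∤p (p * M) (λ _ _ _ → mk⇔ (λ { (a ∷ b) → b , a }) (λ (b , a) → a ∷ b)) ⟩
    X                                    ≡⟨ +-cancelˡ-≡ R X (p′ * R) (begin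
      R + X                                ≡⟨ cong (_+ X) multiples ⟨
      Y + X                                ≡⟨ count-partition (coprimeTo? ps) (p ∣?_) (p * M) ⟨
      count (coprimeTo? ps) (p * M)        ≡⟨ count-periodic (coprimeTo? ps) M (coprimeTo-periodic ps) p 0 ⟩
      p * R                                ∎) ⟩
    p′ * R                               ≡⟨ cong (p′ *_) (count-coprimeTo-product ps ps-prime ps-unique) ⟩
    p′ * φ ps                            ∎
    where
    open ≡-Reasoning
    M = product ps
    R = count (coprimeTo? ps) M
    p∉ : p ∉ ps
    p∉ p∈ = All.lookup p∉′ p∈ refl
    coprime∧∤p = λ n → coprimeTo? ps n ×-dec ¬? (p ∣? n)
    X = count coprime∧∤p (p * M)
    Y = count (λ n → coprimeTo? ps n ×-dec (p ∣? n)) (p * M)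
    multiples : Y ≡ R
    multiples = begin
      Y                                                ≡⟨ count-cong _ (λ n → (p ∣? n) ×-dec coprimeTo? ps n) (p * M) (λ _ _ _ → mk⇔ swap swap) ⟩
      count (λ n → (p ∣? n) ×-dec coprimeTo? ps n) (p * M)  ≡⟨ cong (count (λ n → (p ∣? n) ×-dec coprimeTo? ps n)) (*-comm p M) ⟩
      count (λ n → (p ∣? n) ×-dec coprimeTo? ps n) (M * p)  ≡⟨ count-multiples (coprimeTo? ps) p′ M ⟩
      count (λ m → coprimeTo? ps (m * p)) M            ≡⟨ count-cong _ (coprimeTo? ps) M (λ m _ _ → coprimeTo-*prime ps ps-prime p-prime p∉ m) ⟩
      R                                                ∎
  count-coprimeTo-product (0 ∷ _) (p-prime ∷ _) _ = contradiction p-prime ¬prime[0]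

  module _ {ps} (ps-prime : All Prime ps) where

    indicators-one : indicator (oneOrMultipleOf? ps 1) + indicator (coprimeTo? ps 1) ≡ 2
    indicators-one with oneOrMultipleOf? ps 1 | coprimeTo? ps 1
    ... | yes _ | yes _ = refl
    ... | no ¬one | _ = contradiction (inj₁ refl) ¬one
    ... | _ | no ¬coprime = contradiction (All.map (λ p-prime p∣1 → ¬prime[1] (subst Prime (∣1⇒≡1 p∣1) p-prime)) ps-prime) ¬coprime

    indicators-≥2 : ∀ n → 2 ≤ n → indicator (oneOrMultipleOf? ps n) + indicator (coprimeTo? ps n) ≡ 1
    indicators-≥2 n 2≤n with oneOrMultipleOf? ps n | coprimeTo? ps n
    ... | yes (inj₁ refl) | _ = contradiction 2≤n λ { (s≤s ()) }
    ... | yes (inj₂ ps∣n) | yes ps∤n = contradiction ps∣n (All¬⇒¬Any ps∤n)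
    ... | yes (inj₂ _) | no _ = refl
    ... | no _ | yes _ = refl
    ... | no ¬multiple | no ¬coprime = contradiction (¬Any⇒All¬ ps (¬multiple ∘ inj₂)) ¬coprime

    -- 1 is counted on both sides, every other n on exactly one.
    count-oneOrMultipleOf+count-coprimeTo : ∀ y → count (oneOrMultipleOf? ps) (suc y) + count (coprimeTo? ps) (suc y) ≡ suc (suc y)
    count-oneOrMultipleOf+count-coprimeTo zero = trans (cong₂ _+_ (+-identityʳ (indicator (oneOrMultipleOf? ps 1))) (+-identityʳ (indicator (coprimeTo? ps 1)))) indicators-one
    count-oneOrMultipleOf+count-coprimeTo (suc y) = begin
      (a + x) + (b + z)   ≡⟨ +-assoc a x (b + z) ⟩
      a + (x + (b + z))   ≡⟨ cong (a +_) (x∙yz≈y∙xz x b z) ⟩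
      a + (b + (x + z))   ≡⟨ +-assoc a b (x + z) ⟨
      (a + b) + (x + z)   ≡⟨ cong₂ _+_ (indicators-≥2 (suc (suc y)) (s≤s (s≤s z≤n))) (count-oneOrMultipleOf+count-coprimeTo y) ⟩
      suc (suc (suc y))   ∎
      where
      open ≡-Reasoning
      a = indicator (oneOrMultipleOf? ps (suc (suc y)))
      b = indicator (coprimeTo? ps (suc (suc y)))
      x = count (oneOrMultipleOf? ps) (suc y)
      z = count (coprimeTo? ps) (suc y)

  module _ {ps} (ps-prime : All Prime ps) (ps-unique : Unique ps) where

    private
      M = product ps
      C = count (coprimeTo? ps)
      instance
        M-nonZero : NonZero M
        M-nonZero = >-nonZero (productOfPrimes≥1 ps-prime)

    count-coprimeTo-% : ∀ y → C y ≡ C (y % M) + (y / M) * φ ps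
    count-coprimeTo-% y = begin
      C y                               ≡⟨ cong C (m≡m%n+[m/n]*n y M) ⟩
      C (y % M + (y / M) * M)           ≡⟨ count-periodic (coprimeTo? ps) M (coprimeTo-periodic ps) (y / M) (y % M) ⟩
      C (y % M) + (y / M) * C M         ≡⟨ cong (λ t → C (y % M) + (y / M) * t) (count-coprimeTo-product ps ps-prime ps-unique) ⟩
      C (y % M) + (y / M) * φ ps        ∎
      where open ≡-Reasoning

    private
      expand : ∀ a q b m → (a + q * b) * m ≡ a * m + q * m * b
      expand = solve-∀
      collect : ∀ a q b m s → s * s + (a * m + q * b * m) ≡ (a + q * b) * m + s * s
      collect = solve-∀

    count-coprimeTo-upper : ∀ y → C y * M ≤ y * φ ps + M * M
    count-coprimeTo-upper y = begin
      C y * M                           ≡⟨ cong (_* M) (count-coprimeTo-% y) ⟩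
      (C r + q * φ ps) * M              ≡⟨ expand (C r) q (φ ps) M ⟩
      C r * M + q * M * φ ps            ≤⟨ +-monoˡ-≤ (q * M * φ ps) (*-monoˡ-≤ M (≤-trans (count≤ (coprimeTo? ps) r) r≤M)) ⟩
      M * M + q * M * φ ps              ≤⟨ +-monoʳ-≤ (M * M) (m≤n+m (q * M * φ ps) (r * φ ps)) ⟩
      M * M + (r * φ ps + q * M * φ ps) ≡⟨ collect r q M (φ ps) M ⟩
      (r + q * M) * φ ps + M * M        ≡⟨ cong (λ t → t * φ ps + M * M) (m≡m%n+[m/n]*n y M) ⟨
      y * φ ps + M * M                  ∎
      where
      open ≤-Reasoning
      r = y % M
      q = y / M
      r≤M = <⇒≤ (m%n<n y M)

    count-coprimeTo-lower : ∀ y → y * φ ps ≤ C y * M + M * M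
    count-coprimeTo-lower y = begin
      y * φ ps                          ≡⟨ cong (_* φ ps) (m≡m%n+[m/n]*n y M) ⟩
      (r + q * M) * φ ps                ≡⟨ expand r q M (φ ps) ⟩
      r * φ ps + q * φ ps * M           ≤⟨ +-monoˡ-≤ (q * φ ps * M) (*-mono-≤ r≤M (φ≤product ps)) ⟩
      M * M + q * φ ps * M              ≤⟨ +-monoʳ-≤ (M * M) (m≤n+m (q * φ ps * M) (C r * M)) ⟩
      M * M + (C r * M + q * φ ps * M)  ≡⟨ collect (C r) q (φ ps) M M ⟩
      (C r + q * φ ps) * M + M * M      ≡⟨ cong (λ t → t * M + M * M) (count-coprimeTo-% y) ⟨
      C y * M + M * M                   ∎
      where
      open ≤-Reasoning
      r = y % M
      q = y / M
      r≤M = <⇒≤ (m%n<n y M)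

module Fractions where

  open import Data.Nat as ℕ using (suc)
  open import Data.Integer as ℤ using (+_)
  import Data.Integer.Properties as ℤ
  open import Data.Rational.Unnormalised using (ℚᵘ; mkℚᵘ; _≃_; *≡*; *≤*; *<*; _≤_; _<_; _+_; _*_)
  open import Relation.Binary.PropositionalEquality using (cong; cong₂; sym; trans; subst₂)

  -- frac a b is a / (b + 1).
  frac : ℕ → ℕ → ℚᵘ
  frac a b = mkℚᵘ (+ a) b

  frac-≤ : ∀ a b c d → a ℕ.* suc d ℕ.≤ c ℕ.* suc b → frac a b ≤ frac c d
  frac-≤ a b c d h = *≤* (subst₂ ℤ._≤_ (ℤ.pos-* a (suc d)) (ℤ.pos-* c (suc b)) (ℤ.+≤+ h))

  frac-< : ∀ a b c d → a ℕ.* suc d ℕ.< c ℕ.* suc b → frac a b < frac c d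
  frac-< a b c d h = *<* (subst₂ ℤ._<_ (ℤ.pos-* a (suc d)) (ℤ.pos-* c (suc b)) (ℤ.+<+ h))

  frac-+ : ∀ a b c d → frac a b + frac c d ≃ frac (a ℕ.* suc d ℕ.+ c ℕ.* suc b) (d ℕ.+ b ℕ.* suc d)
  frac-+ a b c d = *≡* (cong (ℤ._* (+ suc (d ℕ.+ b ℕ.* suc d)))
    (trans (cong₂ ℤ._+_ (sym (ℤ.pos-* a (suc d))) (sym (ℤ.pos-* c (suc b)))) (sym (ℤ.pos-+ (a ℕ.* suc d) (c ℕ.* suc b)))))

  frac-* : ∀ a b c d → frac a b * frac c d ≃ frac (a ℕ.* c) (d ℕ.+ b ℕ.* suc d)
  frac-* a b c d = *≡* (cong (ℤ._* (+ suc (d ℕ.+ b ℕ.* suc d))) (sym (ℤ.pos-* a c)))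

module RationalFacts where

  open import Data.Rational as ℚ using (ℚ; toℚᵘ; fromℚᵘ)
  import Data.Rational.Properties as ℚ
  open import Data.Rational.Unnormalised using (ℚᵘ; _≃_; *≡*; 0ℚᵘ; ½; _≤_; _<_; _+_; _*_; _-_; -_; ∣_∣)
  import Data.Rational.Unnormalised.Properties as ℚᵘ
  open import Data.Rational.Unnormalised.Solver using (module +-*-Solver)
  open import Data.Sum using (inj₁; inj₂)
  open import Relation.Binary.PropositionalEquality using (refl; sym; subst)
  open +-*-Solver

  half+half : ∀ u → u * ½ + u * ½ ≃ u
  half+half u = ℚᵘ.≃-trans (solve 2 (λ u h → u :* h :+ u :* h := u :* (h :+ h)) ℚᵘ.≃-refl u ½)
    (ℚᵘ.≃-trans (ℚᵘ.*-congˡ {u} (*≡* refl)) (ℚᵘ.*-identityʳ u))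

  half-pos : ∀ {u} → 0ℚᵘ < u → 0ℚᵘ < u * ½
  half-pos u>0 = ℚᵘ.<-respˡ-≃ (*≡* refl) (ℚᵘ.*-monoˡ-<-pos ½ u>0)

  <⇒0<- : ∀ {a b} → a < b → 0ℚᵘ < b - a
  <⇒0<- {a} a<b = ℚᵘ.<-respˡ-≃ (ℚᵘ.+-inverseʳ a) (ℚᵘ.+-monoˡ-< (- a) a<b)

  <+pos : ∀ a {η} → 0ℚᵘ < η → a < a + η
  <+pos a 0<η = ℚᵘ.<-respˡ-≃ (ℚᵘ.+-identityʳ a) (ℚᵘ.+-monoʳ-< a 0<η)

  ∣-∣≤ : ∀ p q e → p - q ≤ e → q - p ≤ e → ∣ p - q ∣ ≤ e
  ∣-∣≤ p q e p-q≤e q-p≤e with ℚᵘ.∣p∣≡p∨∣p∣≡-p (p - q)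
  ... | inj₁ eq = subst (_≤ e) (sym eq) p-q≤e
  ... | inj₂ eq = subst (_≤ e) (sym eq) (ℚᵘ.≤-respˡ-≃ (solve 2 (λ p q → q :- p := :- (p :- q)) ℚᵘ.≃-refl p q) q-p≤e)

  fromℚᵘ-mono-≤ : ∀ {u v} → u ≤ v → fromℚᵘ u ℚ.≤ fromℚᵘ v
  fromℚᵘ-mono-≤ {u} {v} u≤v = ℚ.toℚᵘ-cancel-≤ (ℚᵘ.≤-respʳ-≃ (ℚᵘ.≃-sym (ℚ.toℚᵘ-fromℚᵘ v)) (ℚᵘ.≤-respˡ-≃ (ℚᵘ.≃-sym (ℚ.toℚᵘ-fromℚᵘ u)) u≤v))

  toℚᵘ<⇒<fromℚᵘ : ∀ {a u} → toℚᵘ a < u → a ℚ.< fromℚᵘ u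
  toℚᵘ<⇒<fromℚᵘ {u = u} a<u = ℚ.toℚᵘ-cancel-< (ℚᵘ.<-respʳ-≃ (ℚᵘ.≃-sym (ℚ.toℚᵘ-fromℚᵘ u)) a<u)

  <toℚᵘ⇒fromℚᵘ< : ∀ {u b} → u < toℚᵘ b → fromℚᵘ u ℚ.< b
  <toℚᵘ⇒fromℚᵘ< {u} u<b = ℚ.toℚᵘ-cancel-< (ℚᵘ.<-respˡ-≃ (ℚᵘ.≃-sym (ℚ.toℚᵘ-fromℚᵘ u)) u<b)

  toℚᵘ-∣fromℚᵘ-fromℚᵘ∣ : ∀ u v → toℚᵘ (ℚ.∣ fromℚᵘ u ℚ.- fromℚᵘ v ∣) ≃ ∣ u - v ∣
  toℚᵘ-∣fromℚᵘ-fromℚᵘ∣ u v = ℚᵘ.≃-trans (ℚ.toℚᵘ-homo-∣-∣ (fromℚᵘ u ℚ.- fromℚᵘ v)) (ℚᵘ.∣-∣-cong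
    (ℚᵘ.≃-trans (ℚ.toℚᵘ-homo-+ (fromℚᵘ u) (ℚ.- fromℚᵘ v))
      (ℚᵘ.+-cong (ℚ.toℚᵘ-fromℚᵘ u) (ℚᵘ.≃-trans (ℚ.toℚᵘ-homo‿- (fromℚᵘ v)) (ℚᵘ.-‿cong (ℚ.toℚᵘ-fromℚᵘ v))))))

module EventuallyClose
  (r : ℕ → ℚᵘ.ℚᵘ) (δ : ℚᵘ.ℚᵘ)
  (close : ∀ η → ℚᵘ.0ℚᵘ ℚᵘ.< η → ∃ λ N → ∀ x → N ℕ.≤ x → r x ℚᵘ.≤ δ ℚᵘ.+ η × δ ℚᵘ.≤ r x ℚᵘ.+ η) where

  open import Data.Rational as ℚ using (ℚ; 0ℚ; toℚᵘ; fromℚᵘ)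
  import Data.Rational.Properties as ℚ
  open import Data.Rational.Unnormalised using (0ℚᵘ; _≤_; _<_; _+_; ½; _*_; _-_; -_)
  import Data.Rational.Unnormalised.Properties as ℚᵘ
  open import Data.Rational.Unnormalised.Solver using (module +-*-Solver)
  open import Data.Nat.Properties using (m≤m+n; m≤n+m; ≤-trans)
  open import Data.Product using (Σ; proj₁; proj₂)
  open RationalFacts
  open +-*-Solver

  r-r≤2η : ∀ {η x y} → r x ≤ δ + η → δ ≤ r y + η → r x - r y ≤ η + η
  r-r≤2η {η} {x} {y} rx≤δ+η δ≤ry+η = begin
    r x - r y               ≤⟨ ℚᵘ.+-monoˡ-≤ (- r y) rx≤δ+η ⟩
    (δ + η) - r y           ≤⟨ ℚᵘ.+-monoˡ-≤ (- r y) (ℚᵘ.+-monoˡ-≤ η δ≤ry+η) ⟩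
    (r y + η + η) - r y     ≃⟨ solve 2 (λ a e → (a :+ e :+ e) :- a := e :+ e) ℚᵘ.≃-refl (r y) η ⟩
    η + η                   ∎
    where open ℚᵘ.≤-Reasoning

  cauchy : ∀ ε → 0ℚ ℚ.< ε → ∃ λ N → ∀ x y → N ℕ.≤ x → N ℕ.≤ y → ℚ.∣ fromℚᵘ (r x) ℚ.- fromℚᵘ (r y) ∣ ℚ.≤ ε
  cauchy ε 0<ε with close (toℚᵘ ε * ½) (half-pos (ℚ.toℚᵘ-mono-< 0<ε))
  ... | N , near = N , λ x y N≤x N≤y → ℚ.toℚᵘ-cancel-≤ (ℚᵘ.≤-respˡ-≃ (ℚᵘ.≃-sym (toℚᵘ-∣fromℚᵘ-fromℚᵘ∣ (r x) (r y)))
      (∣-∣≤ (r x) (r y) (toℚᵘ ε)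
        (ℚᵘ.≤-respʳ-≃ (half+half (toℚᵘ ε)) (r-r≤2η (proj₁ (near x N≤x)) (proj₂ (near y N≤y))))
        (ℚᵘ.≤-respʳ-≃ (half+half (toℚᵘ ε)) (r-r≤2η (proj₁ (near y N≤y)) (proj₂ (near x N≤x))))))

  -- The inner bounds are the midpoints of [a, δ] and [δ, b].
  module _ (a b : ℚ) (a<δ : toℚᵘ a < δ) (δ<b : δ < toℚᵘ b) where

    private
      η₁ = (δ - toℚᵘ a) * ½
      η₂ = (toℚᵘ b - δ) * ½
      0<η₁ = half-pos (<⇒0<- a<δ)
      0<η₂ = half-pos (<⇒0<- δ<b)

    a<δ-η₁ : toℚᵘ a < δ - η₁
    a<δ-η₁ = ℚᵘ.<-respʳ-≃ (ℚᵘ.≃-sym (begin-equality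
      δ - η₁                          ≃⟨ ℚᵘ.+-congˡ (- η₁) (solve 2 (λ d a → d := a :+ (d :- a)) ℚᵘ.≃-refl δ (toℚᵘ a)) ⟩
      toℚᵘ a + (δ - toℚᵘ a) - η₁      ≃⟨ ℚᵘ.+-congˡ (- η₁) (ℚᵘ.+-congʳ (toℚᵘ a) (ℚᵘ.≃-sym (half+half (δ - toℚᵘ a)))) ⟩
      toℚᵘ a + (η₁ + η₁) - η₁         ≃⟨ solve 2 (λ a e → a :+ (e :+ e) :- e := a :+ e) ℚᵘ.≃-refl (toℚᵘ a) η₁ ⟩
      toℚᵘ a + η₁                     ∎)) (<+pos (toℚᵘ a) 0<η₁)
      where open ℚᵘ.≤-Reasoning

    δ+η₂<b : δ + η₂ < toℚᵘ b
    δ+η₂<b = ℚᵘ.<-respʳ-≃ (begin-equality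
      δ + η₂ + η₂                     ≃⟨ ℚᵘ.+-assoc δ η₂ η₂ ⟩
      δ + (η₂ + η₂)                   ≃⟨ ℚᵘ.+-congʳ δ (half+half (toℚᵘ b - δ)) ⟩
      δ + (toℚᵘ b - δ)                ≃⟨ solve 2 (λ d b → d :+ (b :- d) := b) ℚᵘ.≃-refl δ (toℚᵘ b) ⟩
      toℚᵘ b                          ∎) (<+pos (δ + η₂) 0<η₂)
      where open ℚᵘ.≤-Reasoning

    δ-η₁≤δ+η₂ : δ - η₁ ≤ δ + η₂
    δ-η₁≤δ+η₂ = ℚᵘ.≤-trans
      (ℚᵘ.<⇒≤ (ℚᵘ.<-respʳ-≃ (solve 2 (λ d e → d :- e :+ e := d) ℚᵘ.≃-refl δ η₁) (<+pos (δ - η₁) 0<η₁)))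
      (ℚᵘ.<⇒≤ (<+pos δ 0<η₂))

    eventually-within : Σ ℚ λ a′ → Σ ℚ λ b′ → a ℚ.< a′ × a′ ℚ.≤ b′ × b′ ℚ.< b ×
      ∃ λ N → ∀ x → N ℕ.≤ x → a′ ℚ.≤ fromℚᵘ (r x) × fromℚᵘ (r x) ℚ.≤ b′
    eventually-within with close η₁ 0<η₁ | close η₂ 0<η₂
    ... | N₁ , near₁ | N₂ , near₂ =
      fromℚᵘ (δ - η₁) , fromℚᵘ (δ + η₂) , toℚᵘ<⇒<fromℚᵘ a<δ-η₁ , fromℚᵘ-mono-≤ δ-η₁≤δ+η₂ , <toℚᵘ⇒fromℚᵘ< δ+η₂<b ,
      N₁ ℕ.+ N₂ , λ x N≤x →
          fromℚᵘ-mono-≤ (δ-η₁≤ (proj₂ (near₁ x (≤-trans (m≤m+n N₁ N₂) N≤x))))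
        , fromℚᵘ-mono-≤ (proj₁ (near₂ x (≤-trans (m≤n+m N₂ N₁) N≤x)))
      where
      δ-η₁≤ : ∀ {x} → δ ≤ r x + η₁ → δ - η₁ ≤ r x
      δ-η₁≤ {x} h = ℚᵘ.≤-respʳ-≃ (solve 2 (λ a e → a :+ e :- e := a) ℚᵘ.≃-refl (r x) η₁) (ℚᵘ.+-monoˡ-≤ (- η₁) h)

module ConvergentRatios
  (D M′ K : ℕ) (c : ℕ → ℕ)
  (upper : ∀ y → c (ℕ.suc y) ℕ.* ℕ.suc M′ ℕ.≤ ℕ.suc y ℕ.* D ℕ.+ K ℕ.* ℕ.suc M′)
  (lower : ∀ y → ℕ.suc y ℕ.* D ℕ.≤ (c (ℕ.suc y) ℕ.+ K) ℕ.* ℕ.suc M′) where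

  open import Data.Nat using (suc; s≤s)
  open import Data.Nat.Properties as ℕ using (*-monoˡ-≤; *-monoʳ-≤)
  open import Data.Nat.Tactic.RingSolver using (solve-∀)
  open import Data.Integer as ℤ using (+_; +[1+_]; -[1+_])
  open import Data.Rational.Unnormalised using (ℚᵘ; mkℚᵘ; *<*; 0ℚᵘ; _≤_; _<_; _+_)
  import Data.Rational.Unnormalised.Properties as ℚᵘ
  open import Data.Product using (_×_; _,_; ∃)
  open import Relation.Binary.PropositionalEquality using (_≡_; cong)
  open import Data.Rational using (toℚᵘ)
  open import Defs using (IsCounting; HasDensityIn)
  open Fractions

  δ : ℚᵘ
  δ = frac D M′

  r : ℕ → ℚᵘ
  r x = frac (c (suc x)) x

  err : ℕ → ℚᵘ
  err x = frac K x

  r≤δ+err : ∀ x → r x ≤ δ + err x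
  r≤δ+err x = ℚᵘ.≤-respʳ-≃ (ℚᵘ.≃-sym (frac-+ D M′ K x)) (frac-≤ (c y) x _ _ (begin
    c y ℕ.* (M ℕ.* y)                  ≡⟨ shuffle (c y) M y ⟩
    c y ℕ.* M ℕ.* y                    ≤⟨ *-monoˡ-≤ y (upper x) ⟩
    (y ℕ.* D ℕ.+ K ℕ.* M) ℕ.* y        ≡⟨ cong (λ t → (t ℕ.+ K ℕ.* M) ℕ.* y) (ℕ.*-comm y D) ⟩
    (D ℕ.* y ℕ.+ K ℕ.* M) ℕ.* y        ∎))
    where
    open ℕ.≤-Reasoning
    y = suc x
    M = suc M′
    shuffle : ∀ a m y → a ℕ.* (m ℕ.* y) ≡ a ℕ.* m ℕ.* y
    shuffle = solve-∀

  δ≤r+err : ∀ x → δ ≤ r x + err x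
  δ≤r+err x = ℚᵘ.≤-respʳ-≃ (ℚᵘ.≃-sym (frac-+ (c y) x K x)) (frac-≤ D M′ _ _ (begin
    D ℕ.* (y ℕ.* y)                    ≡⟨ shuffle₁ D y ⟩
    y ℕ.* D ℕ.* y                      ≤⟨ *-monoˡ-≤ y (lower x) ⟩
    (c y ℕ.+ K) ℕ.* M ℕ.* y            ≡⟨ shuffle₂ (c y) K M y ⟩
    (c y ℕ.* y ℕ.+ K ℕ.* y) ℕ.* M      ∎))
    where
    open ℕ.≤-Reasoning
    y = suc x
    M = suc M′
    shuffle₁ : ∀ d y → d ℕ.* (y ℕ.* y) ≡ y ℕ.* d ℕ.* y
    shuffle₁ = solve-∀
    shuffle₂ : ∀ c k m y → (c ℕ.+ k) ℕ.* m ℕ.* y ≡ (c ℕ.* y ℕ.+ k ℕ.* y) ℕ.* m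
    shuffle₂ = solve-∀

  err-antitone : ∀ {N x} → N ℕ.≤ x → err x ≤ err N
  err-antitone {N} {x} N≤x = frac-≤ K x K N (*-monoʳ-≤ K (s≤s N≤x))

  err-small : ∀ η → 0ℚᵘ < η → ∃ λ N → err N ≤ η
  err-small (mkℚᵘ (+ 0) d) (*<* (ℤ.+<+ ()))
  err-small (mkℚᵘ -[1+ n ] d) (*<* ())
  err-small (mkℚᵘ +[1+ n ] d) _ = K ℕ.* suc d , frac-≤ K (K ℕ.* suc d) (suc n) d
    (ℕ.≤-trans (ℕ.n≤1+n (K ℕ.* suc d)) (ℕ.m≤n*m (suc (K ℕ.* suc d)) (suc n)))

  r-eventually-close : ∀ η → 0ℚᵘ < η → ∃ λ N → ∀ x → N ℕ.≤ x → r x ≤ δ + η × δ ≤ r x + η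
  r-eventually-close η 0<η with err-small η 0<η
  ... | N , errN≤η = N , λ x N≤x →
      ℚᵘ.≤-trans (r≤δ+err x) (ℚᵘ.+-monoʳ-≤ δ (ℚᵘ.≤-trans (err-antitone N≤x) errN≤η))
    , ℚᵘ.≤-trans (δ≤r+err x) (ℚᵘ.+-monoʳ-≤ (r x) (ℚᵘ.≤-trans (err-antitone N≤x) errN≤η))

  hasDensityIn : ∀ {A} → IsCounting A c → ∀ a b → toℚᵘ a < δ → δ < toℚᵘ b → HasDensityIn A a b
  hasDensityIn counting a b a<δ δ<b = c , counting , cauchy , eventually-within a b a<δ δ<b
    where open EventuallyClose r δ r-eventually-close

module EulerProduct where

  open import Data.Nat as ℕ using (zero; suc; pred; z≤n; s≤s; NonZero; >-nonZero)
  import Data.Nat.Properties as ℕP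
  open import Data.Nat.Tactic.RingSolver using (solve-∀)
  open import Data.Nat.DivMod using (_/_; m/n*n≡m; m/n<m; m/n≤m)
  open import Data.Nat.Divisibility using (_∣_; _∣?_; ∣m⇒∣m*n)
  open import Data.Nat.Primality using (Prime; ¬prime[0]; ¬prime[1])
  open import Data.Nat.Primality.Factorisation
  open import Data.Nat.ListAction using (sum)
  open import Data.Integer as ℤ using (+_)
  open import Data.Rational.Unnormalised as U using (ℚᵘ; _≃_; 0ℚᵘ; 1ℚᵘ)
    renaming (_≤_ to _≤ᵘ_; _<_ to _<ᵘ_; _+_ to _+ᵘ_; _*_ to _*ᵘ_)
  import Data.Rational.Unnormalised.Properties as UP
  open import Data.Rational.Unnormalised.Solver
  open import Data.List using ([]; _∷_; map; filter)
  open import Data.List.Membership.Propositional using (_∈_)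
  open import Data.List.Relation.Unary.Any using (here; there)
  open import Data.List.Relation.Unary.All as All using (All; []; _∷_)
  import Data.List.Relation.Unary.All.Properties as AllP
  open import Data.List.Relation.Unary.Unique.Propositional using (Unique)
  import Data.List.Relation.Unary.Unique.Propositional.Properties as UniqP
  open import Data.List.Relation.Unary.AllPairs using ([]; _∷_)
  open import Data.Product using (_×_; _,_; proj₁)
  open import Data.Empty using (⊥-elim)
  open import Relation.Nullary using (yes; no; ¬_)
  open import Relation.Nullary.Decidable using (¬?)
  open import Relation.Unary using (Decidable)
  open import Relation.Binary.PropositionalEquality
  open Fractions
  open Factorisations using (primeFactor)

  reciprocalSum : List ℕ → ℚᵘ
  reciprocalSum [] = 0ℚᵘ
  reciprocalSum (n ∷ ns) = frac 1 (pred n) +ᵘ reciprocalSum ns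

  coprimeDensity : List ℕ → ℚᵘ
  coprimeDensity [] = 1ℚᵘ
  coprimeDensity (p ∷ ps) = frac (pred p) (pred p) *ᵘ coprimeDensity ps

  Smooth : List ℕ → ℕ → Set
  Smooth ps n = 1 ℕ.≤ n × (∀ q → Prime q → q ∣ n → q ∈ ps)

  frac≥0 : ∀ a b → 0ℚᵘ ≤ᵘ frac a b
  frac≥0 a b = frac-≤ 0 0 a b z≤n

  +-nonNeg : ∀ {x y} → 0ℚᵘ ≤ᵘ x → 0ℚᵘ ≤ᵘ y → 0ℚᵘ ≤ᵘ x +ᵘ y
  +-nonNeg {x} {y} hx hy = UP.≤-respˡ-≃ (UP.+-identityʳ 0ℚᵘ) (UP.+-mono-≤ hx hy)

  *-nonNeg : ∀ {x y} → 0ℚᵘ ≤ᵘ x → 0ℚᵘ ≤ᵘ y → 0ℚᵘ ≤ᵘ x *ᵘ y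
  *-nonNeg {x} {y} hx hy = UP.≤-respˡ-≃ (UP.*-zeroʳ x) (UP.*-monoʳ-≤-nonNeg x {{U.nonNegative hx}} hy)

  reciprocalSum≥0 : ∀ ns → 0ℚᵘ ≤ᵘ reciprocalSum ns
  reciprocalSum≥0 [] = UP.≤-refl
  reciprocalSum≥0 (n ∷ ns) = +-nonNeg (frac≥0 1 (pred n)) (reciprocalSum≥0 ns)

  coprimeDensity≥0 : ∀ ps → 0ℚᵘ ≤ᵘ coprimeDensity ps
  coprimeDensity≥0 [] = frac≥0 1 0
  coprimeDensity≥0 (p ∷ ps) = *-nonNeg (frac≥0 (pred p) (pred p)) (coprimeDensity≥0 ps)

  module _ {P : ℕ → Set} (P? : Decidable P) where
    reciprocalSum-partition : ∀ ns → reciprocalSum ns ≃ reciprocalSum (filter P? ns) +ᵘ reciprocalSum (filter (λ x → ¬? (P? x)) ns)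
    reciprocalSum-partition [] = UP.≃-sym (UP.+-identityʳ 0ℚᵘ)
    reciprocalSum-partition (n ∷ ns) with P? n
    ... | yes _ = UP.≃-trans (UP.+-congʳ (frac 1 (pred n)) (reciprocalSum-partition ns)) (s (frac 1 (pred n)) (reciprocalSum (filter P? ns)) (reciprocalSum (filter (λ x → ¬? (P? x)) ns)))
      where
      open +-*-Solver
      s : ∀ a b c → a +ᵘ (b +ᵘ c) ≃ (a +ᵘ b) +ᵘ c
      s = solve 3 (λ a b c → a :+ (b :+ c) := (a :+ b) :+ c) UP.≃-refl
    ... | no _ = UP.≃-trans (UP.+-congʳ (frac 1 (pred n)) (reciprocalSum-partition ns)) (s (frac 1 (pred n)) (reciprocalSum (filter P? ns)) (reciprocalSum (filter (λ x → ¬? (P? x)) ns)))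
      where
      open +-*-Solver
      s : ∀ a b c → a +ᵘ (b +ᵘ c) ≃ b +ᵘ (a +ᵘ c)
      s = solve 3 (λ a b c → a :+ (b :+ c) := b :+ (a :+ c)) UP.≃-refl

  frac-cong : ∀ a x x′ → suc x ≡ suc x′ → frac a x ≃ frac a x′
  frac-cong a x x′ eq = UP.≃-reflexive (cong (frac a) (ℕP.suc-injective eq))

  module DivideBy (p₀ : ℕ) where
    p = suc p₀
    instance
      p-nz : NonZero p
      p-nz = _

    /-≥1 : ∀ {n} → 1 ℕ.≤ n → p ∣ n → 1 ℕ.≤ n / p
    /-≥1 {n} n≥1 p∣n with n / p in eq
    ... | zero = ⊥-elim (ℕP.<⇒≱ n≥1 (ℕP.≤-reflexive (trans (sym (m/n*n≡m p∣n)) (cong (ℕ._* p) eq))))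
    ... | suc _ = s≤s z≤n

    frac-1/n : ∀ n → 1 ℕ.≤ n → p ∣ n → frac 1 (pred n) ≃ frac 1 p₀ *ᵘ frac 1 (pred (n / p))
    frac-1/n n n≥1 p∣n = UP.≃-trans (frac-cong 1 (pred n) _ eq) (UP.≃-sym (frac-* 1 p₀ 1 (pred (n / p))))
      where
      m = n / p
      m≥1 = /-≥1 n≥1 p∣n
      eq : suc (pred n) ≡ suc (pred m ℕ.+ p₀ ℕ.* suc (pred m))
      eq = begin
          suc (pred n)          ≡⟨ ℕP.suc-pred n {{>-nonZero n≥1}} ⟩
          n                     ≡⟨ sym (m/n*n≡m p∣n) ⟩
          m ℕ.* p               ≡⟨ ℕP.*-comm m p ⟩
          p ℕ.* m               ≡⟨ cong (p ℕ.*_) (sym (ℕP.suc-pred m {{>-nonZero m≥1}})) ⟩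
          p ℕ.* suc (pred m)    ∎
        where open ≡-Reasoning

    reciprocalSum-multiples : ∀ B → All (p ∣_) B → All (1 ℕ.≤_) B → reciprocalSum B ≃ frac 1 p₀ *ᵘ reciprocalSum (map (_/ p) B)
    reciprocalSum-multiples [] [] [] = UP.≃-sym (UP.*-zeroʳ (frac 1 p₀))
    reciprocalSum-multiples (n ∷ B) (d ∷ ds) (g ∷ gs) = UP.≃-trans (UP.+-cong (frac-1/n n g d) (reciprocalSum-multiples B ds gs)) (s (frac 1 p₀) (frac 1 (pred (n / p))) (reciprocalSum (map (_/ p) B)))
      where
      open +-*-Solver
      s : ∀ t a b → t *ᵘ a +ᵘ t *ᵘ b ≃ t *ᵘ (a +ᵘ b)
      s = solve 3 (λ t a b → t :* a :+ t :* b := t :* (a :+ b)) UP.≃-refl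

    /-injective : ∀ {x y} → p ∣ x → p ∣ y → x / p ≡ y / p → x ≡ y
    /-injective {x} {y} dx dy eq = trans (sym (m/n*n≡m dx)) (trans (cong (ℕ._* p) eq) (m/n*n≡m dy))

    Unique-map-/ : ∀ B → Unique B → All (p ∣_) B → Unique (map (_/ p) B)
    Unique-map-/ [] [] [] = []
    Unique-map-/ (x ∷ B) (px ∷ u) (dx ∷ ds) = AllP.map⁺ (All.zipWith (λ (ne , dz) eq → ne (/-injective dx dz eq)) (px , ds)) ∷ Unique-map-/ B u ds

    sum-map-/-≤ : ∀ B → sum (map (_/ p) B) ℕ.≤ sum B
    sum-map-/-≤ [] = z≤n
    sum-map-/-≤ (x ∷ B) = ℕP.+-mono-≤ (m/n≤m x p) (sum-map-/-≤ B)

    Smooth-/ : ∀ ps n → Smooth ps n → p ∣ n → Smooth ps (n / p)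
    Smooth-/ ps n (n≥1 , h) p∣n = /-≥1 n≥1 p∣n , λ q q-prime q∣ → h q q-prime (subst (q ∣_) (m/n*n≡m p∣n) (∣m⇒∣m*n p q∣))

  module DivideBy₂ (p₁ : ℕ) where
    open DivideBy (suc p₁)
    sum-map-/-< : ∀ b B → 1 ℕ.≤ b → sum (map (_/ suc (suc p₁)) (b ∷ B)) ℕ.< sum (b ∷ B)
    sum-map-/-< b B b≥1 = ℕP.+-mono-<-≤ (m/n<m b (suc (suc p₁)) {{>-nonZero b≥1}} (s≤s (s≤s z≤n))) (sum-map-/-≤ B)

  sum-filter≤ : ∀ {P : ℕ → Set} (P? : Decidable P) ns → sum (filter P? ns) ℕ.≤ sum ns
  sum-filter≤ P? [] = z≤n
  sum-filter≤ P? (n ∷ ns) with P? n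
  ... | yes _ = ℕP.+-monoʳ-≤ n (sum-filter≤ P? ns)
  ... | no _ = ℕP.≤-trans (sum-filter≤ P? ns) (ℕP.m≤n+m _ n)

  reciprocalSum≤1-[] : ∀ ns → Unique ns → All (Smooth []) ns → reciprocalSum ns ≤ᵘ 1ℚᵘ
  reciprocalSum≤1-[] [] _ _ = frac-≤ 0 0 1 0 z≤n
  reciprocalSum≤1-[] (n ∷ ns) (pn ∷ u) ((n≥1 , h) ∷ rest) with n ℕ.≟ 1
  ... | no n≢1 with primeFactor (ℕP.≤∧≢⇒< n≥1 (λ eq → n≢1 (sym eq)))
  ...   | q , q-prime , q∣ with () ← h q q-prime q∣
  reciprocalSum≤1-[] (.1 ∷ []) (pn ∷ u) ((n≥1 , h) ∷ rest) | yes refl = UP.≤-reflexive (UP.+-identityʳ 1ℚᵘ)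
  reciprocalSum≤1-[] (.1 ∷ m ∷ ns) ((1≢m ∷ _) ∷ u) ((n≥1 , h) ∷ (m≥1 , hm) ∷ rest) | yes refl with m ℕ.≟ 1
  ... | yes refl = ⊥-elim (1≢m refl)
  ... | no m≢1 with primeFactor (ℕP.≤∧≢⇒< m≥1 (λ eq → m≢1 (sym eq)))
  ...   | q , q-prime , q∣ with () ← hm q q-prime q∣

  frac-complement : ∀ p₁ → frac 1 (suc p₁) +ᵘ frac (suc p₁) (suc p₁) ≃ 1ℚᵘ
  frac-complement p₁ = UP.≃-trans (frac-+ 1 (suc p₁) (suc p₁) (suc p₁))
    (UP.≤-antisym (frac-≤ _ _ 1 0 (ℕP.≤-reflexive (e p₁))) (frac-≤ 1 0 _ _ (ℕP.≤-reflexive (sym (e p₁)))))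
    where
    e : ∀ p₁ → (1 ℕ.* suc (suc p₁) ℕ.+ suc p₁ ℕ.* suc (suc p₁)) ℕ.* 1 ≡ 1 ℕ.* suc (suc p₁ ℕ.+ suc p₁ ℕ.* suc (suc p₁))
    e = solve-∀

  module EulerStep (p₁ : ℕ) (ps : List ℕ) (p-prime : Prime (suc (suc p₁))) (ps-prime : All Prime ps) (fuel : ℕ) (ns : List ℕ)
    (sum≤ : sum ns ℕ.≤ suc fuel) (ns-unique : Unique ns) (ns-smooth : All (Smooth (suc (suc p₁) ∷ ps)) ns) where
    p = suc (suc p₁)
    open DivideBy (suc p₁) hiding (p)
    open DivideBy₂ p₁
    B = filter (p ∣?_) ns
    A = filter (λ x → ¬? (p ∣? x)) ns
    B′ = map (_/ p) B
    1/p = frac 1 (suc p₁)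
    [p-1]/p = frac (suc p₁) (suc p₁)
    π′ = coprimeDensity ps
    B-multiples : All (p ∣_) B
    B-multiples = AllP.all-filter (p ∣?_) ns
    B-smooth : All (Smooth (p ∷ ps)) B
    B-smooth = AllP.filter⁺ (p ∣?_) ns-smooth
    A-nonMultiples : All (λ n → ¬ p ∣ n) A
    A-nonMultiples = AllP.all-filter (λ x → ¬? (p ∣? x)) ns
    A-smooth : All (Smooth ps) A
    A-smooth = All.zipWith (λ { (¬q-prime , (n≥1 , h)) → n≥1 , λ r rP r∣ → restrict ¬q-prime r∣ (h r rP r∣) }) (A-nonMultiples , AllP.filter⁺ (λ x → ¬? (p ∣? x)) ns-smooth)
      where
      restrict : ∀ {n r} → ¬ p ∣ n → r ∣ n → r ∈ p ∷ ps → r ∈ ps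
      restrict ¬q-prime r∣ (here refl) = ⊥-elim (¬q-prime r∣)
      restrict ¬q-prime r∣ (there m) = m
    A-sum : sum A ℕ.≤ suc fuel
    A-sum = ℕP.≤-trans (sum-filter≤ _ ns) sum≤
    A-unique : Unique A
    A-unique = UniqP.filter⁺ _ ns-unique
    sum-quotients : ∀ B → sum B ℕ.≤ suc fuel → All (1 ℕ.≤_) B → sum (map (_/ p) B) ℕ.≤ fuel
    sum-quotients [] _ _ = z≤n
    sum-quotients (b ∷ B) le (b≥1 ∷ _) = ℕP.≤-pred (ℕP.≤-trans (sum-map-/-< b B b≥1) le)
    B-positive : All (1 ℕ.≤_) B
    B-positive = All.map proj₁ B-smooth
    B′-sum : sum B′ ℕ.≤ fuel
    B′-sum = sum-quotients B (ℕP.≤-trans (sum-filter≤ _ ns) sum≤) B-positive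
    B′-unique : Unique B′
    B′-unique = Unique-map-/ B (UniqP.filter⁺ _ ns-unique) B-multiples
    B′-smooth : All (Smooth (p ∷ ps)) B′
    B′-smooth = AllP.map⁺ (All.zipWith (λ (s , d) → Smooth-/ (p ∷ ps) _ s d) (B-smooth , B-multiples))
    combine : reciprocalSum A *ᵘ π′ ≤ᵘ 1ℚᵘ → reciprocalSum B′ *ᵘ coprimeDensity (p ∷ ps) ≤ᵘ 1ℚᵘ → reciprocalSum ns *ᵘ ([p-1]/p *ᵘ π′) ≤ᵘ 1ℚᵘ
    combine A-bound B′-bound = begin
        reciprocalSum ns *ᵘ ([p-1]/p *ᵘ π′)
      ≃⟨ UP.*-congʳ (reciprocalSum-partition (p ∣?_) ns) ⟩
        (reciprocalSum B +ᵘ reciprocalSum A) *ᵘ ([p-1]/p *ᵘ π′)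
      ≃⟨ UP.*-congʳ (UP.+-congˡ (reciprocalSum A) (reciprocalSum-multiples B B-multiples B-positive)) ⟩
        (1/p *ᵘ reciprocalSum B′ +ᵘ reciprocalSum A) *ᵘ ([p-1]/p *ᵘ π′)
      ≃⟨ s 1/p (reciprocalSum B′) (reciprocalSum A) [p-1]/p π′ ⟩
        1/p *ᵘ (reciprocalSum B′ *ᵘ ([p-1]/p *ᵘ π′)) +ᵘ [p-1]/p *ᵘ (reciprocalSum A *ᵘ π′)
      ≤⟨ UP.+-mono-≤ (UP.*-monoʳ-≤-nonNeg 1/p B′-bound) (UP.*-monoʳ-≤-nonNeg [p-1]/p A-bound) ⟩
        1/p *ᵘ 1ℚᵘ +ᵘ [p-1]/p *ᵘ 1ℚᵘ
      ≃⟨ UP.+-cong (UP.*-identityʳ 1/p) (UP.*-identityʳ [p-1]/p) ⟩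
        1/p +ᵘ [p-1]/p
      ≃⟨ frac-complement p₁ ⟩
        1ℚᵘ
      ∎
      where
      open UP.≤-Reasoning
      open +-*-Solver
      s : ∀ t b a q π → (t *ᵘ b +ᵘ a) *ᵘ (q *ᵘ π) ≃ t *ᵘ (b *ᵘ (q *ᵘ π)) +ᵘ q *ᵘ (a *ᵘ π)
      s = solve 5 (λ t b a q π → (t :* b :+ a) :* (q :* π) := t :* (b :* (q :* π)) :+ q :* (a :* π)) UP.≃-refl

  -- Splitting ns by divisibility by p, the multiples contribute 1/p times the sum over their quotients
  -- (again p ∷ ps-smooth, with smaller total) and the rest is ps-smooth: 1/p + (p-1)/p = 1.
  reciprocalSum*coprimeDensity≤1 : ∀ ps → All Prime ps → ∀ ns → Unique ns → All (Smooth ps) ns → reciprocalSum ns *ᵘ coprimeDensity ps ≤ᵘ 1ℚᵘ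
  reciprocalSum*coprimeDensity≤1 ps ps-prime ns = bounded ps ps-prime (sum ns) ns ℕP.≤-refl
    where
    bounded : ∀ ps → All Prime ps → ∀ fuel ns → sum ns ℕ.≤ fuel → Unique ns → All (Smooth ps) ns → reciprocalSum ns *ᵘ coprimeDensity ps ≤ᵘ 1ℚᵘ
    bounded [] [] fuel ns _ ns-unique ns-smooth = UP.≤-respˡ-≃ (UP.≃-sym (UP.*-identityʳ (reciprocalSum ns))) (reciprocalSum≤1-[] ns ns-unique ns-smooth)
    bounded (zero ∷ ps) (p-prime ∷ _) _ _ _ _ _ = ⊥-elim (¬prime[0] p-prime)
    bounded (suc zero ∷ ps) (p-prime ∷ _) _ _ _ _ _ = ⊥-elim (¬prime[1] p-prime)
    bounded (suc (suc p₁) ∷ ps) _ zero ns sum≤0 _ ns-smooth = UP.≤-trans (UP.≤-reflexive (UP.*-congʳ (ns≃[] ns sum≤0 ns-smooth))) (UP.≤-trans (UP.≤-reflexive (UP.*-zeroˡ (coprimeDensity (suc (suc p₁) ∷ ps)))) (frac-≤ 0 0 1 0 z≤n))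
      where
      ns≃[] : ∀ ns → sum ns ℕ.≤ 0 → All (Smooth (suc (suc p₁) ∷ ps)) ns → reciprocalSum ns ≃ 0ℚᵘ
      ns≃[] [] _ _ = UP.≃-refl
      ns≃[] (n ∷ ns) sum≤0 ((1≤n , _) ∷ _) = ⊥-elim (ℕP.<⇒≱ 1≤n (ℕP.≤-trans (ℕP.m≤m+n n (sum ns)) sum≤0))
    bounded (suc (suc p₁) ∷ ps) (p-prime ∷ ps-prime) (suc fuel) ns sum≤ ns-unique ns-smooth =
      S.combine (bounded ps ps-prime (suc fuel) S.A S.A-sum S.A-unique S.A-smooth) (bounded (suc (suc p₁) ∷ ps) (p-prime ∷ ps-prime) fuel S.B′ S.B′-sum S.B′-unique S.B′-smooth)
      where module S = EulerStep p₁ ps p-prime ps-prime fuel ns sum≤ ns-unique ns-smooth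

module HarmonicDivergence where

  open import Data.Nat as ℕ using (zero; suc; pred; z≤n; s≤s; _^_; >-nonZero)
  import Data.Nat.Properties as ℕP
  open import Data.Nat.Tactic.RingSolver using (solve-∀)
  open import Data.Nat.Divisibility using (∣⇒≤)
  open import Data.Nat.Primality using (Prime; prime?)
  open import Data.Rational.Unnormalised as U using (ℚᵘ; _≃_; *≡*; 0ℚᵘ; 1ℚᵘ)
    renaming (_≤_ to _≤ᵘ_; _<_ to _<ᵘ_; _+_ to _+ᵘ_; _*_ to _*ᵘ_)
  import Data.Rational.Unnormalised.Properties as UP
  open import Data.Rational.Unnormalised.Solver
  open import Data.List using ([]; _∷_; _++_)
  open import Data.List.Membership.Propositional using (_∈_)
  open import Data.List.Relation.Unary.Any using (here; there)
  open import Data.List.Relation.Unary.All as All using (All; []; _∷_)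
  open import Data.List.Relation.Unary.Unique.Propositional using (Unique)
  open import Data.List.Relation.Unary.AllPairs using ([]; _∷_)
  open import Data.Product using (_×_; _,_)
  open import Data.Empty using (⊥-elim)
  open import Relation.Nullary using (Dec; yes; no)
  open import Relation.Binary.PropositionalEquality
  open Fractions
  open Factorisations using (prime≥2)
  open EulerProduct

  consIfPrime : ∀ {n} → Dec (Prime n) → List ℕ → List ℕ
  consIfPrime {n} (yes _) l = n ∷ l
  consIfPrime (no _) l = l

  primesIn : ℕ → ℕ → List ℕ
  primesIn b zero = []
  primesIn b (suc k) = consIfPrime (prime? (b ℕ.+ suc k)) (primesIn b k)

  primesIn-prime : ∀ b k → All Prime (primesIn b k)
  primesIn-prime b zero = []
  primesIn-prime b (suc k) with prime? (b ℕ.+ suc k)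
  ... | yes p-prime = p-prime ∷ primesIn-prime b k
  ... | no _ = primesIn-prime b k

  primesIn-bounds-weaken : ∀ b k → All (λ q → b ℕ.< q × q ℕ.≤ b ℕ.+ k) (primesIn b k) → All (λ q → b ℕ.< q × q ℕ.≤ b ℕ.+ suc k) (primesIn b k)
  primesIn-bounds-weaken b k = All.map (λ (l , u) → l , ℕP.≤-trans u (ℕP.+-monoʳ-≤ b (ℕP.n≤1+n k)))

  primesIn-bounds : ∀ b k → All (λ q → b ℕ.< q × q ℕ.≤ b ℕ.+ k) (primesIn b k)
  primesIn-bounds b zero = []
  primesIn-bounds b (suc k) with prime? (b ℕ.+ suc k)
  ... | yes p-prime = (ℕP.m<m+n b (s≤s z≤n) , ℕP.≤-refl) ∷ primesIn-bounds-weaken b k (primesIn-bounds b k)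
  ... | no _ = primesIn-bounds-weaken b k (primesIn-bounds b k)

  primesIn-unique : ∀ b k → Unique (primesIn b k)
  primesIn-unique b zero = []
  primesIn-unique b (suc k) with prime? (b ℕ.+ suc k)
  ... | yes p-prime = All.map (λ (_ , u) eq → ℕP.<-irrefl (sym eq) (ℕP.≤-trans (s≤s u) (ℕP.≤-reflexive (sym (ℕP.+-suc b k))))) (primesIn-bounds b k) ∷ primesIn-unique b k
  ... | no _ = primesIn-unique b k

  ∈-primesIn : ∀ b k q → Prime q → b ℕ.< q → q ℕ.≤ b ℕ.+ k → q ∈ primesIn b k
  ∈-primesIn b zero q q-prime b<q q≤ = ⊥-elim (ℕP.<⇒≱ b<q (ℕP.≤-trans q≤ (ℕP.≤-reflexive (ℕP.+-identityʳ b))))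
  ∈-primesIn b (suc k) q q-prime b<q q≤ with q ℕ.≟ b ℕ.+ suc k | prime? (b ℕ.+ suc k)
  ... | yes refl | yes _ = here refl
  ... | yes refl | no ¬q-prime = ⊥-elim (¬q-prime q-prime)
  ... | no q≢ | yes _ = there (∈-primesIn b k q q-prime b<q (ℕP.≤-pred (ℕP.≤-trans (ℕP.≤∧≢⇒< q≤ q≢) (ℕP.≤-reflexive (ℕP.+-suc b k)))))
  ... | no q≢ | no _ = ∈-primesIn b k q q-prime b<q (ℕP.≤-pred (ℕP.≤-trans (ℕP.≤∧≢⇒< q≤ q≢) (ℕP.≤-reflexive (ℕP.+-suc b k))))

  consIfPrime-++ : ∀ {n} (d : Dec (Prime n)) l1 l2 → consIfPrime d (l1 ++ l2) ≡ consIfPrime d l1 ++ l2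
  consIfPrime-++ (yes _) l1 l2 = refl
  consIfPrime-++ (no _) l1 l2 = refl

  consIfPrime-cong : ∀ {n m} → n ≡ m → ∀ l → consIfPrime (prime? n) l ≡ consIfPrime (prime? m) l
  consIfPrime-cong refl l = refl

  primesIn-++ : ∀ y k → primesIn 0 (y ℕ.+ k) ≡ primesIn y k ++ primesIn 0 y
  primesIn-++ y zero = cong (primesIn 0) (ℕP.+-identityʳ y)
  primesIn-++ y (suc k) = begin
    primesIn 0 (y ℕ.+ suc k)                                            ≡⟨ cong (primesIn 0) (ℕP.+-suc y k) ⟩
    consIfPrime (prime? (suc (y ℕ.+ k))) (primesIn 0 (y ℕ.+ k))         ≡⟨ cong (consIfPrime (prime? (suc (y ℕ.+ k)))) (primesIn-++ y k) ⟩
    consIfPrime (prime? (suc (y ℕ.+ k))) (primesIn y k ++ primesIn 0 y) ≡⟨ consIfPrime-cong (sym (ℕP.+-suc y k)) _ ⟩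
    consIfPrime (prime? (y ℕ.+ suc k)) (primesIn y k ++ primesIn 0 y)   ≡⟨ consIfPrime-++ (prime? (y ℕ.+ suc k)) (primesIn y k) (primesIn 0 y) ⟩
    primesIn y (suc k) ++ primesIn 0 y                                  ∎
    where open ≡-Reasoning

  coprimeDensity-++ : ∀ xs ys → coprimeDensity (xs ++ ys) ≃ coprimeDensity xs *ᵘ coprimeDensity ys
  coprimeDensity-++ [] ys = UP.≃-sym (UP.*-identityˡ (coprimeDensity ys))
  coprimeDensity-++ (x ∷ xs) ys = UP.≃-trans (UP.*-congˡ {frac (pred x) (pred x)} (coprimeDensity-++ xs ys)) (UP.≃-sym (UP.*-assoc (frac (pred x) (pred x)) (coprimeDensity xs) (coprimeDensity ys)))

  *-pos : ∀ {x y} → 0ℚᵘ <ᵘ x → 0ℚᵘ <ᵘ y → 0ℚᵘ <ᵘ x *ᵘ y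
  *-pos {x} {y} hx hy = UP.<-respˡ-≃ (UP.*-zeroʳ x) (UP.*-monoʳ-<-pos x {{U.positive hx}} hy)

  coprimeDensity-pos : ∀ ps → All Prime ps → 0ℚᵘ <ᵘ coprimeDensity ps
  coprimeDensity-pos [] [] = frac-< 0 0 1 0 (s≤s z≤n)
  coprimeDensity-pos (p ∷ ps) (p-prime ∷ ps-prime) = *-pos (frac-< 0 0 (pred p) (pred p) (ℕP.≤-trans (ℕP.pred-mono-≤ (prime≥2 p-prime)) (ℕP.≤-reflexive (sym (ℕP.*-identityʳ (pred p)))))) (coprimeDensity-pos ps ps-prime)

  coprimeDensity≤1 : ∀ ps → coprimeDensity ps ≤ᵘ 1ℚᵘ
  coprimeDensity≤1 [] = UP.≤-refl
  coprimeDensity≤1 (p ∷ ps) = UP.≤-trans (UP.*-monoˡ-≤-nonNeg (coprimeDensity ps) {{U.nonNegative (coprimeDensity≥0 ps)}} (frac-≤ (pred p) (pred p) 1 0 (ℕP.≤-trans (ℕP.≤-reflexive (ℕP.*-identityʳ (pred p))) (ℕP.≤-trans (ℕP.n≤1+n (pred p)) (ℕP.≤-reflexive (sym (ℕP.*-identityˡ (suc (pred p)))))))))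
    (UP.≤-trans (UP.≤-reflexive (UP.*-identityˡ (coprimeDensity ps))) (coprimeDensity≤1 ps))

  upTo⁺ : ℕ → List ℕ
  upTo⁺ zero = []
  upTo⁺ (suc n) = suc n ∷ upTo⁺ n

  harmonic : ℕ → ℚᵘ
  harmonic n = reciprocalSum (upTo⁺ n)

  upTo⁺-bounds : ∀ n → All (λ m → 1 ℕ.≤ m × m ℕ.≤ n) (upTo⁺ n)
  upTo⁺-bounds zero = []
  upTo⁺-bounds (suc n) = (s≤s z≤n , ℕP.≤-refl) ∷ All.map (λ (a , b) → a , ℕP.m≤n⇒m≤1+n b) (upTo⁺-bounds n)

  upTo⁺-unique : ∀ n → Unique (upTo⁺ n)
  upTo⁺-unique zero = []
  upTo⁺-unique (suc n) = All.map (λ (_ , b) eq → ℕP.<-irrefl (sym eq) (s≤s b)) (upTo⁺-bounds n) ∷ upTo⁺-unique n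

  upTo⁺-smooth : ∀ Z → All (Smooth (primesIn 0 Z)) (upTo⁺ Z)
  upTo⁺-smooth Z = All.map (λ {m} (m≥1 , m≤Z) → m≥1 , λ q q-prime q∣ → ∈-primesIn 0 Z q q-prime (ℕP.≤-trans (s≤s z≤n) (prime≥2 q-prime)) (ℕP.≤-trans (∣⇒≤ {{>-nonZero m≥1}} q∣) m≤Z)) (upTo⁺-bounds Z)

  harmonic*coprimeDensity≤1 : ∀ Z → harmonic Z *ᵘ coprimeDensity (primesIn 0 Z) ≤ᵘ 1ℚᵘ
  harmonic*coprimeDensity≤1 Z = reciprocalSum*coprimeDensity≤1 (primesIn 0 Z) (primesIn-prime 0 Z) (upTo⁺ Z) (upTo⁺-unique Z) (upTo⁺-smooth Z)

  frac-0 : ∀ m → frac 0 m ≃ 0ℚᵘ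
  frac-0 m = *≡* refl

  frac-split : ∀ k s → frac (suc k) (suc s) ≤ᵘ frac 1 s +ᵘ frac k s
  frac-split k s = UP.≤-respʳ-≃ (UP.≃-sym (frac-+ 1 s k s)) (frac-≤ (suc k) (suc s) _ _ (begin
    suc k ℕ.* suc (s ℕ.+ s ℕ.* suc s)             ≡⟨ e1 k s ⟩
    suc k ℕ.* suc s ℕ.* suc s                     ≤⟨ ℕP.*-monoʳ-≤ (suc k ℕ.* suc s) (ℕP.n≤1+n (suc s)) ⟩
    suc k ℕ.* suc s ℕ.* suc (suc s)               ≡⟨ e2 k s ⟨
    (1 ℕ.* suc s ℕ.+ k ℕ.* suc s) ℕ.* suc (suc s) ∎))
    where
    open ℕP.≤-Reasoning
    e1 : ∀ k s → suc k ℕ.* suc (s ℕ.+ s ℕ.* suc s) ≡ suc k ℕ.* suc s ℕ.* suc s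
    e1 = solve-∀
    e2 : ∀ k s → (1 ℕ.* suc s ℕ.+ k ℕ.* suc s) ℕ.* suc (suc s) ≡ suc k ℕ.* suc s ℕ.* suc (suc s)
    e2 = solve-∀

  harmonic-block : ∀ m k → harmonic m +ᵘ frac k (k ℕ.+ m) ≤ᵘ harmonic (k ℕ.+ m)
  harmonic-block m zero = UP.≤-reflexive (UP.≃-trans (UP.+-congʳ (harmonic m) (frac-0 m)) (UP.+-identityʳ (harmonic m)))
  harmonic-block m (suc k) = begin
      harmonic m +ᵘ frac (suc k) (suc s′)
    ≤⟨ UP.+-monoʳ-≤ (harmonic m) (frac-split k s′) ⟩
      harmonic m +ᵘ (frac 1 s′ +ᵘ frac k s′)
    ≃⟨ sh (harmonic m) (frac 1 s′) (frac k s′) ⟩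
      frac 1 s′ +ᵘ (harmonic m +ᵘ frac k s′)
    ≤⟨ UP.+-monoʳ-≤ (frac 1 s′) (harmonic-block m k) ⟩
      frac 1 s′ +ᵘ harmonic s′
    ∎
    where
    open UP.≤-Reasoning
    s′ = k ℕ.+ m
    sh : ∀ a b c → a +ᵘ (b +ᵘ c) ≃ b +ᵘ (a +ᵘ c)
    sh = solve 3 (λ a b c → a :+ (b :+ c) := b :+ (a :+ c)) UP.≃-refl
      where open +-*-Solver

  harmonic-mono : ∀ a b → harmonic b ≤ᵘ harmonic (a ℕ.+ b)
  harmonic-mono a b = UP.≤-trans (UP.≤-respˡ-≃ (UP.+-identityʳ (harmonic b)) (UP.+-monoʳ-≤ (harmonic b) (frac≥0 a (a ℕ.+ b)))) (harmonic-block b a)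

  harmonic-2^ : ∀ j → frac j 2 ≤ᵘ harmonic (2 ^ j)
  harmonic-2^ zero = UP.≤-trans (UP.≤-reflexive (frac-0 2)) (UP.≤-respˡ-≃ (UP.+-identityʳ 0ℚᵘ) (UP.+-mono-≤ (frac≥0 1 0) (UP.≤-refl {0ℚᵘ})))
  harmonic-2^ (suc j) = begin
      frac (suc j) 2
    ≃⟨ UP.≃-sym sum3 ⟩
      frac j 2 +ᵘ frac 1 2
    ≤⟨ UP.+-monoˡ-≤ (frac 1 2) (harmonic-2^ j) ⟩
      harmonic n +ᵘ frac 1 2
    ≤⟨ UP.+-monoʳ-≤ (harmonic n) (frac-≤ 1 2 n (n ℕ.+ n) (ℕP.≤-trans (ℕP.≤-reflexive (e0 n)) (ℕP.≤-trans (ℕP.+-monoˡ-≤ (n ℕ.+ n) n≥1) (ℕP.≤-reflexive (e1 n))))) ⟩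
      harmonic n +ᵘ frac n (n ℕ.+ n)
    ≤⟨ harmonic-block n n ⟩
      harmonic (n ℕ.+ n)
    ≡⟨ cong (λ t → harmonic (n ℕ.+ t)) (sym (ℕP.+-identityʳ n)) ⟩
      harmonic (2 ^ suc j)
    ∎
    where
    open UP.≤-Reasoning
    n = 2 ^ j
    n≥1 = ℕP.m^n>0 2 j
    e0 : ∀ n → 1 ℕ.* suc (n ℕ.+ n) ≡ 1 ℕ.+ (n ℕ.+ n)
    e0 = solve-∀
    e1 : ∀ n → n ℕ.+ (n ℕ.+ n) ≡ n ℕ.* 3
    e1 = solve-∀
    sum3 : frac j 2 +ᵘ frac 1 2 ≃ frac (suc j) 2
    sum3 = UP.≃-trans (frac-+ j 2 1 2) (UP.≤-antisym (frac-≤ _ _ _ _ (ℕP.≤-reflexive (e j))) (frac-≤ _ _ _ _ (ℕP.≤-reflexive (sym (e j)))))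
      where
      e : ∀ j → (j ℕ.* 3 ℕ.+ 1 ℕ.* 3) ℕ.* 3 ≡ suc j ℕ.* suc (2 ℕ.+ 2 ℕ.* 3)
      e = solve-∀

module DenseProducts where

  open import Data.Nat as ℕ using (zero; suc; pred; z≤n; s≤s; _^_; >-nonZero)
  import Data.Nat.Properties as ℕP
  open import Data.Nat.Tactic.RingSolver using (solve-∀)
  open import Data.Nat.Primality using (Prime; prime?; ¬prime[0]; ¬prime[1]; productOfPrimes≥1)
  open import Data.Nat.ListAction using (product)
  open import Data.Integer as ℤ using (+_; +[1+_]; -[1+_])
  open import Data.Rational.Unnormalised as U using (ℚᵘ; mkℚᵘ; _≃_; *<*; 0ℚᵘ; 1ℚᵘ)
    renaming (_≤_ to _≤ᵘ_; _<_ to _<ᵘ_; _+_ to _+ᵘ_; _*_ to _*ᵘ_; _-_ to _-ᵘ_; -_ to -ᵘ_)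
  import Data.Rational.Unnormalised.Properties as UP
  open import Data.Rational.Unnormalised.Solver
  open import Data.List using ([]; _∷_)
  open import Data.List.Relation.Unary.All as All using (All; []; _∷_)
  open import Data.List.Relation.Unary.Unique.Propositional using (Unique)
  open import Data.Product using (_×_; _,_; proj₁; proj₂; ∃)
  open import Data.Empty using (⊥-elim)
  open import Relation.Nullary using (Dec; yes; no)
  open import Relation.Binary.PropositionalEquality
  open Fractions
  open EulerProduct
  open Factorisations using (prime≥2)
  open HarmonicDivergence
  open CoprimeResidues using (φ)

  archimedean-K/3 : ∀ κ → 0ℚᵘ <ᵘ κ → ∃ λ K → 1ℚᵘ <ᵘ frac K 2 *ᵘ κ
  archimedean-K/3 (mkℚᵘ (+ zero) d) (*<* (ℤ.+<+ ()))
  archimedean-K/3 (mkℚᵘ -[1+ n ] d) (*<* ())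
  archimedean-K/3 (mkℚᵘ +[1+ n ] d) _ = K , UP.<-respʳ-≃ (UP.≃-sym (frac-* K 2 (suc n) d)) (frac-< 1 0 (K ℕ.* suc n) (d ℕ.+ 2 ℕ.* suc d) lt)
    where
    K = suc (3 ℕ.* suc d)
    e : ∀ d → 1 ℕ.* suc (d ℕ.+ 2 ℕ.* suc d) ≡ 3 ℕ.* suc d
    e = solve-∀
    lt : 1 ℕ.* suc (d ℕ.+ 2 ℕ.* suc d) ℕ.< K ℕ.* suc n ℕ.* 1
    lt = ℕP.≤-trans (s≤s (ℕP.≤-reflexive (e d))) (ℕP.≤-trans (ℕP.m≤m*n K (suc n)) (ℕP.≤-reflexive (sym (ℕP.*-identityʳ _))))

  archimedean-1/ : ∀ η → 0ℚᵘ <ᵘ η → ∃ λ y′ → frac 1 y′ ≤ᵘ η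
  archimedean-1/ (mkℚᵘ (+ zero) d) (*<* (ℤ.+<+ ()))
  archimedean-1/ (mkℚᵘ -[1+ n ] d) (*<* ())
  archimedean-1/ (mkℚᵘ +[1+ n ] d) _ = d , frac-≤ 1 d (suc n) d (ℕP.≤-trans (ℕP.≤-reflexive (ℕP.*-identityˡ (suc d))) (ℕP.m≤n*m (suc d) (suc n)))

  -- Otherwise (K/3) ∏_{p≤y} (1 - 1/p) β ≤ H(y + 2^K) ∏_{p≤y+2^K} (1 - 1/p) ≤ 1.
  coprimeDensity-primesIn-small : ∀ y β → 0ℚᵘ <ᵘ β → ∃ λ k → coprimeDensity (primesIn y k) <ᵘ β
  coprimeDensity-primesIn-small y β β>0 with archimedean-K/3 (coprimeDensity (primesIn 0 y) *ᵘ β) (*-pos (coprimeDensity-pos _ (primesIn-prime 0 y)) β>0)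
  ... | K , 1<K with coprimeDensity (primesIn y (2 ^ K)) UP.<? β
  ...   | yes lt = 2 ^ K , lt
  ...   | no nlt = ⊥-elim (UP.<-irrefl UP.≃-refl (UP.<-≤-trans 1<K chain))
    where
    k = 2 ^ K
    Z = y ℕ.+ k
    c0 = coprimeDensity (primesIn 0 y)
    πt = coprimeDensity (primesIn y k)
    c0≥0 = UP.<⇒≤ (coprimeDensity-pos _ (primesIn-prime 0 y))
    β≤πt : β ≤ᵘ πt
    β≤πt = UP.≮⇒≥ nlt
    HZ = harmonic Z
    HZ≥0 = reciprocalSum≥0 (upTo⁺ Z)
    frK≤H : frac K 2 ≤ᵘ HZ
    frK≤H = UP.≤-trans (harmonic-2^ K) (harmonic-mono y k)
    πsplit : coprimeDensity (primesIn 0 Z) ≃ πt *ᵘ c0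
    πsplit = UP.≃-trans (UP.≃-reflexive (cong coprimeDensity (primesIn-++ y k))) (coprimeDensity-++ (primesIn y k) (primesIn 0 y))
    chain : frac K 2 *ᵘ (c0 *ᵘ β) ≤ᵘ 1ℚᵘ
    chain = begin
        frac K 2 *ᵘ (c0 *ᵘ β)
      ≤⟨ UP.*-monoˡ-≤-nonNeg (c0 *ᵘ β) {{U.nonNegative (*-nonNeg c0≥0 (UP.<⇒≤ β>0))}} frK≤H ⟩
        HZ *ᵘ (c0 *ᵘ β)
      ≤⟨ UP.*-monoʳ-≤-nonNeg HZ {{U.nonNegative HZ≥0}} (UP.*-monoʳ-≤-nonNeg c0 {{U.nonNegative c0≥0}} β≤πt) ⟩
        HZ *ᵘ (c0 *ᵘ πt)
      ≃⟨ UP.*-congˡ {HZ} (UP.≃-trans (UP.*-comm c0 πt) (UP.≃-sym πsplit)) ⟩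
        HZ *ᵘ coprimeDensity (primesIn 0 Z)
      ≤⟨ harmonic*coprimeDensity≤1 Z ⟩
        1ℚᵘ
      ∎
      where open UP.≤-Reasoning

  module Greedy (α β : ℚᵘ) (α≥0 : 0ℚᵘ ≤ᵘ α) (α<β : α <ᵘ β) (β≤1 : β ≤ᵘ 1ℚᵘ) where
    β>0 : 0ℚᵘ <ᵘ β
    β>0 = UP.≤-<-trans α≥0 α<β
    η = β -ᵘ α
    η>0 : 0ℚᵘ <ᵘ η
    η>0 = UP.<-respˡ-≃ (UP.+-inverseʳ α) (UP.+-monoˡ-< (-ᵘ α) α<β)
    y′ = proj₁ (archimedean-1/ η η>0)
    y′≤ : frac 1 y′ ≤ᵘ η
    y′≤ = proj₂ (archimedean-1/ η η>0)
    y = suc y′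

    crossing : ∀ k → coprimeDensity (primesIn y k) <ᵘ β → ∃ λ j → (β ≤ᵘ coprimeDensity (primesIn y j)) × (coprimeDensity (primesIn y (suc j)) <ᵘ β)
    crossing zero h = ⊥-elim (UP.<-irrefl UP.≃-refl (UP.<-≤-trans h β≤1))
    crossing (suc k) h with coprimeDensity (primesIn y k) UP.<? β
    ... | yes h′ = crossing k h′
    ... | no h′ = k , UP.≮⇒≥ h′ , h

    appendPrime : ∀ n (d : Dec (Prime n)) l → y ℕ.< n → β ≤ᵘ coprimeDensity l → coprimeDensity (consIfPrime d l) <ᵘ β → α <ᵘ coprimeDensity (consIfPrime d l)
    appendPrime n (no _) l _ β≤πl πpl<β = ⊥-elim (UP.<-irrefl UP.≃-refl (UP.<-≤-trans πpl<β β≤πl))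
    appendPrime zero (yes p-prime) l _ _ _ = ⊥-elim (¬prime[0] p-prime)
    appendPrime (suc zero) (yes p-prime) l _ _ _ = ⊥-elim (¬prime[1] p-prime)
    appendPrime (suc (suc n₁)) (yes p-prime) l y<n β≤πl πpl<β = UP.<-respˡ-≃ (s1 α t) (UP.<-respʳ-≃ (s1 π′ t) (UP.+-monoˡ-< (-ᵘ t) key))
      where
      open +-*-Solver
      π = coprimeDensity l
      t = frac 1 (suc n₁)
      q = frac (suc n₁) (suc n₁)
      π′ = q *ᵘ π
      s1 : ∀ a t → a +ᵘ t -ᵘ t ≃ a
      s1 = solve 2 (λ a t → a :+ t :- t := a) UP.≃-refl
      t<η : t <ᵘ η
      t<η = UP.<-≤-trans (frac-< 1 (suc n₁) 1 y′ (subst₂ ℕ._<_ (sym (ℕP.*-identityˡ (suc y′))) (sym (ℕP.*-identityˡ (suc (suc n₁)))) y<n)) y′≤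
      π≤ : π ≤ᵘ π′ +ᵘ t
      π≤ = begin
          π                        ≃⟨ UP.≃-sym (UP.*-identityˡ π) ⟩
          1ℚᵘ *ᵘ π                 ≃⟨ UP.*-congʳ {π} (UP.≃-sym (frac-complement n₁)) ⟩
          (t +ᵘ q) *ᵘ π            ≃⟨ s2 t q π ⟩
          π′ +ᵘ t *ᵘ π             ≤⟨ UP.+-monoʳ-≤ π′ (UP.*-monoʳ-≤-nonNeg t (coprimeDensity≤1 l)) ⟩
          π′ +ᵘ t *ᵘ 1ℚᵘ           ≃⟨ UP.+-congʳ π′ (UP.*-identityʳ t) ⟩
          π′ +ᵘ t                  ∎
        where
        open UP.≤-Reasoning
        s2 : ∀ t q π → (t +ᵘ q) *ᵘ π ≃ q *ᵘ π +ᵘ t *ᵘ π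
        s2 = solve 3 (λ t q π → (t :+ q) :* π := q :* π :+ t :* π) UP.≃-refl
      key : α +ᵘ t <ᵘ π′ +ᵘ t
      key = begin-strict
          α +ᵘ t        <⟨ UP.+-monoʳ-< α t<η ⟩
          α +ᵘ η        ≃⟨ s3 α β ⟩
          β             ≤⟨ β≤πl ⟩
          π             ≤⟨ π≤ ⟩
          π′ +ᵘ t       ∎
        where
        open UP.≤-Reasoning
        s3 : ∀ a b → a +ᵘ (b -ᵘ a) ≃ b
        s3 = solve 2 (λ a b → a :+ (b :- a) := b) UP.≃-refl

    between : ∃ λ ps → All Prime ps × Unique ps × (α <ᵘ coprimeDensity ps) × (coprimeDensity ps <ᵘ β)
    between with coprimeDensity-primesIn-small y β β>0
    ... | k , πk<β with crossing k πk<β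
    ...   | j , β≤πl , πpl<β = primesIn y (suc j) , primesIn-prime y (suc j) , primesIn-unique y (suc j) ,
            appendPrime (y ℕ.+ suc j) (prime? (y ℕ.+ suc j)) (primesIn y j) (ℕP.m<m+n y (s≤s z≤n)) β≤πl πpl<β , πpl<β

  coprimeDensity-dense : ∀ α β → 0ℚᵘ ≤ᵘ α → α <ᵘ β → β ≤ᵘ 1ℚᵘ → ∃ λ ps → All Prime ps × Unique ps × α <ᵘ coprimeDensity ps × coprimeDensity ps <ᵘ β
  coprimeDensity-dense α β 0≤α α<β β≤1 = Greedy.between α β 0≤α α<β β≤1

  coprimeDensity≃φ/product : ∀ ps → All Prime ps → coprimeDensity ps ≃ frac (φ ps) (pred (product ps))
  coprimeDensity≃φ/product [] [] = UP.≃-refl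
  coprimeDensity≃φ/product (p ∷ ps) (p-prime ∷ ps-prime) = UP.≃-trans (UP.*-congˡ {frac (pred p) (pred p)} (coprimeDensity≃φ/product ps ps-prime))
    (UP.≃-trans (frac-* (pred p) (pred p) (φ ps) (pred (product ps))) (frac-cong _ _ _ eq))
    where
    M = product ps
    M≥1 = productOfPrimes≥1 ps-prime
    p≥1 = ℕP.≤-trans (s≤s z≤n) (prime≥2 p-prime)
    eq : suc (pred M ℕ.+ pred p ℕ.* suc (pred M)) ≡ suc (pred (p ℕ.* M))
    eq = begin
        suc (pred p) ℕ.* suc (pred M)   ≡⟨ cong₂ ℕ._*_ (ℕP.suc-pred p {{>-nonZero p≥1}}) (ℕP.suc-pred M {{>-nonZero M≥1}}) ⟩
        p ℕ.* M                         ≡⟨ sym (ℕP.suc-pred (p ℕ.* M) {{>-nonZero (ℕP.*-mono-≤ p≥1 M≥1)}}) ⟩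
        suc (pred (p ℕ.* M))            ∎
      where open ≡-Reasoning

module PracticalDensity (ps : List ℕ) (ps-prime : All Prime ps) (ps-unique : Unique ps) where

  open import Data.Nat using (suc; pred; _+_; _*_; _∸_; _^_; _≤_; z≤n; s≤s; >-nonZero)
  open import Data.Nat.Properties
  open import Data.Nat.Primality using (productOfPrimes≥1)
  open import Data.Nat.ListAction using (product)
  open import Data.Nat.Tactic.RingSolver using (solve-∀)
  open import Data.Product using (_×_; _,_)
  open import Relation.Nullary using (yes; no; ¬_; contradiction)
  open import Relation.Binary.PropositionalEquality
  open import Defs using (Practical; Multiplicative; PositiveValued; PrimePowerMonotone; IsCounting; HasDensityIn)
  open import Data.Rational using (toℚᵘ)
  import Data.Rational.Unnormalised as ℚᵘ
  open import Data.Rational.Unnormalised using (1ℚᵘ)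
  import Data.Rational.Unnormalised.Properties as ℚᵘP
  open import Data.Rational.Unnormalised.Solver using (module +-*-Solver)
  open Fractions
  open EulerProduct using (coprimeDensity)
  open DenseProducts using (coprimeDensity≃φ/product)
  open Counting
  open OneOrMultiple
  open CoprimeResidues
  open Construction ps
  open Factorisations using (prime≥2)
  open PracticalNumbers ps ps-prime

  c = count (oneOrMultipleOf? ps)

  counting : IsCounting (Practical f) c
  counting = refl , λ x → step x
    where
    step : ∀ x → (Practical f (suc x) → c (suc x) ≡ suc (c x)) × (¬ Practical f (suc x) → c (suc x) ≡ c x)
    step x with oneOrMultipleOf? ps (suc x)
    ... | yes one-or-multiple = (λ _ → refl) , λ ¬practical → contradiction (practical⁺ (s≤s z≤n) one-or-multiple) ¬practical
    ... | no ¬one-or-multiple = (λ practical → contradiction (practical⁻ practical) ¬one-or-multiple) , λ _ → refl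

  f-multiplicative : Multiplicative f
  f-multiplicative = refl , λ m n 1≤m 1≤n _ → f-* 1≤m 1≤n

  f-positive : PositiveValued f
  f-positive n _ = f≥1 n

  f-primePowerMonotone : PrimePowerMonotone f
  f-primePowerMonotone p k p-prime = subst (f (p ^ k) ≤_) (sym (f-* 1≤p (m^n>0 p {{>-nonZero 1≤p}} k)))
    (m≤n*m (f (p ^ k)) (f p) {{>-nonZero (f≥1 p)}})
    where 1≤p = ≤-trans (s≤s z≤n) (prime≥2 p-prime)

  private
    M = product ps
    C = count (coprimeTo? ps)
    D = M ∸ φ ps
    D+φ≡M : D + φ ps ≡ M
    D+φ≡M = m∸n+n≡m (φ≤product ps)

  c*M+C*M≡ : ∀ y → c (suc y) * M + C (suc y) * M ≡ suc y * D + suc y * φ ps + M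
  c*M+C*M≡ y = begin
    c (suc y) * M + C (suc y) * M        ≡⟨ *-distribʳ-+ M (c (suc y)) (C (suc y)) ⟨
    (c (suc y) + C (suc y)) * M          ≡⟨ cong (_* M) (count-oneOrMultipleOf+count-coprimeTo ps-prime y) ⟩
    M + suc y * M                        ≡⟨ cong (λ t → M + suc y * t) D+φ≡M ⟨
    M + suc y * (D + φ ps)               ≡⟨ expand M (suc y) D (φ ps) ⟩
    suc y * D + suc y * φ ps + M         ∎
    where
    open ≡-Reasoning
    expand : ∀ m y d e → m + y * (d + e) ≡ y * d + y * e + m
    expand = solve-∀

  count-oneOrMultipleOf-upper : ∀ y → c (suc y) * M ≤ suc y * D + suc M * M
  count-oneOrMultipleOf-upper y = +-cancelʳ-≤ (C (suc y) * M) _ _ (begin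
    c (suc y) * M + C (suc y) * M                   ≡⟨ c*M+C*M≡ y ⟩
    suc y * D + suc y * φ ps + M                    ≤⟨ +-monoˡ-≤ M (+-monoʳ-≤ (suc y * D) (count-coprimeTo-lower ps-prime ps-unique (suc y))) ⟩
    suc y * D + (C (suc y) * M + M * M) + M         ≡⟨ regroup (suc y * D) (C (suc y) * M) M ⟩
    suc y * D + suc M * M + C (suc y) * M           ∎)
    where
    open ≤-Reasoning
    regroup : ∀ a b m → a + (b + m * m) + m ≡ a + suc m * m + b
    regroup = solve-∀

  count-oneOrMultipleOf-lower : ∀ y → suc y * D ≤ (c (suc y) + suc M) * M
  count-oneOrMultipleOf-lower y = begin
    suc y * D                                  ≤⟨ m≤m+n (suc y * D) M ⟩
    suc y * D + M                              ≤⟨ +-cancelʳ-≤ (suc y * φ ps) _ _ shifted ⟩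
    c (suc y) * M + M * M                      ≤⟨ +-monoʳ-≤ (c (suc y) * M) (m≤n+m (M * M) M) ⟩
    c (suc y) * M + suc M * M                  ≡⟨ *-distribʳ-+ M (c (suc y)) (suc M) ⟨
    (c (suc y) + suc M) * M                    ∎
    where
    open ≤-Reasoning
    swap₂ : ∀ a b m → a + b + m ≡ a + m + b
    swap₂ = solve-∀
    shifted : suc y * D + M + suc y * φ ps ≤ c (suc y) * M + M * M + suc y * φ ps
    shifted = begin
      suc y * D + M + suc y * φ ps             ≡⟨ swap₂ (suc y * D) (suc y * φ ps) M ⟨
      suc y * D + suc y * φ ps + M             ≡⟨ c*M+C*M≡ y ⟨
      c (suc y) * M + C (suc y) * M            ≤⟨ +-monoʳ-≤ (c (suc y) * M) (count-coprimeTo-upper ps-prime ps-unique (suc y)) ⟩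
      c (suc y) * M + (suc y * φ ps + M * M)   ≡⟨ +-assoc (c (suc y) * M) _ _ ⟨
      c (suc y) * M + suc y * φ ps + M * M     ≡⟨ swap₂ (c (suc y) * M) (suc y * φ ps) (M * M) ⟩
      c (suc y) * M + M * M + suc y * φ ps     ∎

  private
    M′ = pred M
    M≡1+M′ : M ≡ suc M′
    M≡1+M′ = sym (suc-pred M {{>-nonZero (productOfPrimes≥1 ps-prime)}})

  open ConvergentRatios D M′ (suc M) c
    (λ y → subst (λ m → c (suc y) * m ≤ suc y * D + suc M * m) M≡1+M′ (count-oneOrMultipleOf-upper y))
    (λ y → subst (λ m → suc y * D ≤ (c (suc y) + suc M) * m) M≡1+M′ (count-oneOrMultipleOf-lower y))

  δ≃1-coprimeDensity : δ ℚᵘ.≃ 1ℚᵘ ℚᵘ.- coprimeDensity ps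
  δ≃1-coprimeDensity = ℚᵘP.≃-trans (solve 2 (λ d e → d := (d :+ e) :- e) ℚᵘP.≃-refl δ (frac (φ ps) M′))
    (ℚᵘP.+-cong δ+φ/M≃1 (ℚᵘP.-‿cong (ℚᵘP.≃-sym (coprimeDensity≃φ/product ps ps-prime))))
    where
    open +-*-Solver
    δ+φ/M≃1 : δ ℚᵘ.+ frac (φ ps) M′ ℚᵘ.≃ 1ℚᵘ
    δ+φ/M≃1 = ℚᵘP.≃-trans (frac-+ D M′ (φ ps) M′) (ℚᵘP.≤-antisym (frac-≤ _ _ 1 0 (≤-reflexive eq)) (frac-≤ 1 0 _ _ (≤-reflexive (sym eq))))
      where
      e1 : ∀ d f s → (d * s + f * s) * 1 ≡ (d + f) * s
      e1 = solve-∀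
      e2 : ∀ m → suc m * suc m ≡ 1 * suc (m + m * suc m)
      e2 = solve-∀
      eq : (D * suc M′ + φ ps * suc M′) * 1 ≡ 1 * suc (M′ + M′ * suc M′)
      eq = trans (e1 D (φ ps) (suc M′)) (trans (cong (_* suc M′) (trans D+φ≡M M≡1+M′)) (e2 M′))

  practical-hasDensityIn : ∀ a b → toℚᵘ a ℚᵘ.< 1ℚᵘ ℚᵘ.- coprimeDensity ps → 1ℚᵘ ℚᵘ.- coprimeDensity ps ℚᵘ.< toℚᵘ b → HasDensityIn (Practical f) a b
  practical-hasDensityIn a b a<δ δ<b = hasDensityIn {Practical f} counting a b
    (ℚᵘP.<-respʳ-≃ (ℚᵘP.≃-sym δ≃1-coprimeDensity) a<δ) (ℚᵘP.<-respˡ-≃ (ℚᵘP.≃-sym δ≃1-coprimeDensity) δ<b)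

module Complements where

  open import Data.Rational.Unnormalised using (*≡*; 0ℚᵘ; 1ℚᵘ; _≃_; _≤_; _<_; _-_)
  open import Data.Rational.Unnormalised.Properties
  open import Data.Rational.Unnormalised.Solver using (module +-*-Solver)
  open import Relation.Binary.PropositionalEquality using (refl)
  open +-*-Solver

  1-‿mono-< : ∀ {x y} → x < y → 1ℚᵘ - y < 1ℚᵘ - x
  1-‿mono-< x<y = +-monoʳ-< 1ℚᵘ (neg-mono-< x<y)

  1-‿nonNeg : ∀ {x} → 0ℚᵘ ≤ x → 1ℚᵘ - x ≤ 1ℚᵘ
  1-‿nonNeg 0≤x = ≤-respʳ-≃ (*≡* refl) (+-monoʳ-≤ 1ℚᵘ (neg-mono-≤ 0≤x))

  1-[1-x]≃x : ∀ x → 1ℚᵘ - (1ℚᵘ - x) ≃ x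
  1-[1-x]≃x = solve 1 (λ x → con 1ℚᵘ :- (con 1ℚᵘ :- x) := x) ≃-refl

  <1-‿⇒ : ∀ {x y} → x < 1ℚᵘ - y → y < 1ℚᵘ - x
  <1-‿⇒ {x} {y} x<1-y = <-respˡ-≃ (1-[1-x]≃x y) (1-‿mono-< x<1-y)

  1-‿<⇒ : ∀ {x y} → 1ℚᵘ - x < y → 1ℚᵘ - y < x
  1-‿<⇒ {x} {y} 1-x<y = <-respʳ-≃ (1-[1-x]≃x x) (1-‿mono-< 1-x<y)

open import Defs
open import Data.Rational using (ℚ; 0ℚ; 1ℚ; _≤_; _<_; toℚᵘ)
import Data.Rational.Properties as ℚ
open import Data.Rational.Unnormalised using (1ℚᵘ; _-_)
open import Data.Rational.Unnormalised.Properties using (p≤q⇒0≤q-p)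
open import Data.Product using (Σ; _×_; _,_)
open Complements
open DenseProducts using (coprimeDensity-dense)
open EulerProduct using (coprimeDensity)

theorem1p7 : (a b : ℚ) → 0ℚ ≤ a → a < b → b ≤ 1ℚ →
    Σ (ℕ → ℕ) λ f → Multiplicative f × PositiveValued f × PrimePowerMonotone f ×
    HasDensityIn (Practical f) a b
theorem1p7 a b 0≤a a<b b≤1 = witness (coprimeDensity-dense (1ℚᵘ - toℚᵘ b) (1ℚᵘ - toℚᵘ a)
  (p≤q⇒0≤q-p (ℚ.toℚᵘ-mono-≤ b≤1)) (1-‿mono-< (ℚ.toℚᵘ-mono-< a<b)) (1-‿nonNeg (ℚ.toℚᵘ-mono-≤ 0≤a)))
  where
  witness : (∃ λ ps → All Prime ps × Unique ps × 1ℚᵘ - toℚᵘ b ℚᵘ.< coprimeDensity ps × coprimeDensity ps ℚᵘ.< 1ℚᵘ - toℚᵘ a) →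
    Σ (ℕ → ℕ) λ f → Multiplicative f × PositiveValued f × PrimePowerMonotone f × HasDensityIn (Practical f) a b
  witness (ps , ps-prime , ps-unique , 1-b<π , π<1-a) =
    f , f-multiplicative , f-positive , f-primePowerMonotone , practical-hasDensityIn a b (<1-‿⇒ π<1-a) (1-‿<⇒ 1-b<π)
    where
    open Construction ps using (f)
    open PracticalDensity ps ps-prime ps-unique
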